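{- Let $\mu,\nu,q\in\mathbb{C}$ and let $X,Y$ satisfy $XY-qYX=\mu I+\nu Y$ (the $q$-deformed generalized Ore algebra $\mathcal{O}_{\mu,\nu}(q)$). Then for every $m\in\mathbb{N}$, $$(X+Y)^m=\sum_{k=0}^{m}\sum_{\ell=k}^{m}\sum_{t=0}^{\ell-k}\mathfrak{O}_{m,k,\ell,t}(q)\,Y^{m-\ell-t}X^{k},\qquad \mathfrak{O}_{m,k,\ell,t}(q)=\sum_{\lambda\in\mathcal{I}_{m-\ell,\ell}} m_{t,\ell-k-t}(B_{\omega_\lambda};q).$$
   Context: For $0\le\ell\le m$, $\mathcal{I}_{m-\ell,\ell}$ is the set of integer sequences $\lambda=(\lambda_1,\dots,\lambda_\ell)$ with $m-\ell\ge\lambda_1\ge\lambda_2\ge\cdots\ge\lambda_\ell\ge 0$ (Young diagrams in an $(m-\ell)\times\ell$ box; for $\ell=0$ only the empty sequence). For such $\lambda$, $\omega_\lambda=XY^{\lambda_1-\lambda_2}XY^{\lambda_2-\lambda_3}\cdots XY^{\lambda_{\ell-1}-\lambda_\ell}XY^{\lambda_\ell}$ (a word with $\ell$ letters $X$; empty word if $\ell=0$). Board of a word: for a word $\omega$ in $X,Y$, draw the lattice path from $(0,0)$ reading $\omega$ left to right, $X$ a unit step right, $Y$ a unit step up; $B_\omega$ is the Ferrers board of unit cells above the path, with $x\ge0$ and below $y=$ (number of $Y$'s). Equivalently, columns correspond to the $X$'s, rows to the $Y$'s (the $j$-th $Y$ from the left is the $j$-th row from the bottom), and the column of an $X$ has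 a cell in the row of each $Y$ to its right. "Above" means in a higher row. Mixed placements: $\mathcal{M}_{k,\ell}(B)$ is the set of placements of $k$ rooks and $\ell$ files in distinct cells of $B$ such that no two rooks share a row or column, no two files share a column, no file and rook share a column, and no file lies in the same row as a rook and to its left. For such a placement, a cell is cancelled if it contains no rook/file and lies above a rook in its column, or to the left of a rook in its row, or above a file in its column; cells containing nothing and not cancelled are empty boxes. $m_{k,\ell}(B;q)=\mu^k\nu^\ell\sum_{\phi\in\mathcal{M}_{k,\ell}(B)}q^{\#\text{empty boxes of }\phi}$ (so $m_{0,0}(B;q)=q^{|B|}$, and $m_{k,\ell}=0$ if there is no such placement). -}

module Defs where

open import Data.Nat using (ℕ; zero; suc; _∸_; _≡ᵇ_; _<ᵇ_) renaming (_+_ to _+ℕ_)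
open import Data.Bool using (Bool; true; false; _∧_; _∨_; not)
open import Data.List using (List; []; _∷_; _++_; map; concatMap; length; zip; replicate; upTo; foldr)
open import Data.Bool.ListAction using (any)
open import Data.Product using (_×_; _,_; proj₁; proj₂)
open import Algebra.Bundles using (Ring)

data Letter : Set where
  X Y : Letter

Word : Set
Word = List Letter

omega : List ℕ → Word
omega []            = []
omega (a ∷ [])      = X ∷ replicate a Y
omega (a ∷ b ∷ lam) = X ∷ (replicate (a ∸ b) Y ++ omega (b ∷ lam))

-- I_{a,ℓ}: weakly decreasing sequences of length ℓ with entries in [0,a]
partsBox : ℕ → ℕ → List (List ℕ)
partsBox a zero    = [] ∷ []
partsBox a (suc n) = concatMap (λ x → map (x ∷_) (partsBox x n)) (upTo (suc a))

-- A cell is (column , row), 0-based: column i is the (i+1)-th X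
-- of the word, row j is the (j+1)-th Y from the left (= (j+1)-th row
-- from the bottom).  The column of an X has a cell in the row of each Y
-- to its right.

Cell : Set
Cell = ℕ × ℕ

yRows : ℕ → Word → List ℕ
yRows cy []      = []
yRows cy (X ∷ w) = yRows cy w
yRows cy (Y ∷ w) = cy ∷ yRows (suc cy) w

board' : ℕ → ℕ → Word → List Cell
board' cx cy []      = []
board' cx cy (X ∷ w) = map (λ r → (cx , r)) (yRows cy w) ++ board' (suc cx) cy w
board' cx cy (Y ∷ w) = board' cx (suc cy) w

board : Word → List Cell
board = board' 0 0

data Content : Set where
  none rook file : Content

isRook isFile isNone : Content → Bool
isRook rook = true
isRook _    = false
isFile file = true
isFile _    = false
isNone none = true
isNone _    = false

Placement : Set
Placement = List (Cell × Content)

assignments : ℕ → List (List Content)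
assignments zero    = [] ∷ []
assignments (suc n) =
  concatMap (λ c → map (c ∷_) (assignments n)) (none ∷ rook ∷ file ∷ [])

allPlacements : List Cell → List Placement
allPlacements B = map (zip B) (assignments (length B))

filterB : {A : Set} → (A → Bool) → List A → List A
filterB p []       = []
filterB p (x ∷ xs) with p x
... | true  = x ∷ filterB p xs
... | false = filterB p xs

countB : {A : Set} → (A → Bool) → List A → ℕ
countB p xs = length (filterB p xs)

noDup : List ℕ → Bool
noDup []       = true
noDup (x ∷ xs) = not (any (x ≡ᵇ_) xs) ∧ noDup xs

rooksOf filesOf : Placement → List Cell
rooksOf p = map proj₁ (filterB (λ e → isRook (proj₂ e)) p)
filesOf p = map proj₁ (filterB (λ e → isFile (proj₂ e)) p)

validMixed : ℕ → ℕ → Placement → Bool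
validMixed k l p =
  (length rs ≡ᵇ k) ∧ (length fs ≡ᵇ l)
  ∧ noDup (map proj₁ rs) ∧ noDup (map proj₂ rs)
  ∧ noDup (map proj₁ fs)
  ∧ not (any (λ f → any (λ r → proj₁ f ≡ᵇ proj₁ r) rs) fs)
  ∧ not (any (λ f → any (λ r → (proj₂ f ≡ᵇ proj₂ r) ∧ (proj₁ f <ᵇ proj₁ r)) rs) fs)
  where
  rs = rooksOf p
  fs = filesOf p

mixedPlacements : ℕ → ℕ → List Cell → List Placement
mixedPlacements k l B = filterB (validMixed k l) (allPlacements B)

-- cancellation of a cell (c , r) (only used for cells containing nothing)
cancelled : Placement → Cell → Bool
cancelled p (c , r) =
     any (λ x → (c ≡ᵇ proj₁ x) ∧ (proj₂ x <ᵇ r)) (rooksOf p)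
  ∨ any (λ x → (r ≡ᵇ proj₂ x) ∧ (c <ᵇ proj₁ x)) (rooksOf p)
  ∨ any (λ x → (c ≡ᵇ proj₁ x) ∧ (proj₂ x <ᵇ r)) (filesOf p)

emptyBoxes : Placement → ℕ
emptyBoxes p = countB (λ e → isNone (proj₂ e) ∧ not (cancelled p (proj₁ e))) p

-- [a, b] as a list (empty if b < a)
range : ℕ → ℕ → List ℕ
range a b = map (a +ℕ_) (upTo (suc b ∸ a))

module _ {c ℓ} (R : Ring c ℓ) where
  open Ring R

  pow : Carrier → ℕ → Carrier
  pow x zero    = 1#
  pow x (suc n) = x * pow x n

  sumR : List Carrier → Carrier
  sumR = foldr _+_ 0#

  Central : Carrier → Set _
  Central x = ∀ z → x * z ≈ z * x

  mixedRookPoly : (μ ν q : Carrier) → ℕ → ℕ → List Cell → Carrier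
  mixedRookPoly μ ν q k l B =
    pow μ k * pow ν l * sumR (map (λ φ → pow q (emptyBoxes φ)) (mixedPlacements k l B))

  frakO : (μ ν q : Carrier) → ℕ → ℕ → ℕ → ℕ → Carrier
  frakO μ ν q m k l t =
    sumR (map (λ lam → mixedRookPoly μ ν q t (l ∸ k ∸ t) (board (omega lam))) (partsBox (m ∸ l) l))

  oreExpansion : (μ ν q x y : Carrier) → ℕ → Carrier
  oreExpansion μ ν q x y m =
    sumR (map (λ k →
      sumR (map (λ l →
        sumR (map (λ t → frakO μ ν q m k l t * pow y (m ∸ l ∸ t) * pow x k)
                  (range 0 (l ∸ k))))
           (range k m)))
         (range 0 m))

module Submission where

-- Expanding (x + y)^m gives the sum of all words of length m in x and y, and the words with l
-- letters x are exactly y^(m-l-λ₁) ω_λ for λ in the (m-l) × l box. Each word ω is put in normal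
-- order by induction on its letters from the left: a leading y raises the powers of y, and a leading x
-- is moved to the right with x y^j = q^j y^j x + [j]_q (μ y^(j-1) + ν y^j). On the board side a
-- leading X adds a leftmost column with one cell per Y, and sorting the mixed placements by the content
-- of that column (empty, one rook or one file) gives the matching recursion
--   m_{t,f}(B) = q^(n-t) m_{t,f}(B′) + μ [n-t+1]_q m_{t-1,f}(B′) + ν [n-t]_q m_{t,f-1}(B′),
-- where n is the height of the column. Hence ω = Σ_{k+t+f=#X} m_{t,f}(B_ω) y^(#Y-t) x^k, and
-- regrouping the sum over l, λ, k and t gives the theorem.

open import Defs
open import Algebra.Bundles using (Ring)
import Algebra.Solver.CommutativeMonoid as CommutativeMonoidSolver
open import Data.Bool using (Bool; true; false; _∧_; _∨_; not; if_then_else_; T)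
open import Data.Bool.ListAction using (any; or)
open import Data.Bool.Properties using (∧-zeroʳ; ∧-identityʳ; ∨-identityʳ; ∨-zeroʳ; ∨-comm; ∧-commutativeMonoid)
open import Data.Empty using (⊥; ⊥-elim)
open import Data.List using (List; []; _∷_; _++_; map; concatMap; length; zip; replicate; upTo)
import Data.List.Properties as List
open import Data.List.Relation.Unary.All as All using (All; []; _∷_)
import Data.List.Relation.Unary.All.Properties as All
open import Data.Nat as ℕ using (ℕ; zero; suc; pred; _∸_; _≤_; _<_; z≤n; s≤s; _≡ᵇ_; _<ᵇ_)
import Data.Nat.Properties as ℕ
open import Data.Product using (_×_; _,_; proj₁; proj₂)
open import Data.Sum using (inj₁; inj₂)
open import Function using (_∘_)
open import Relation.Binary.PropositionalEquality as ≡ using (_≡_)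
open import Relation.Nullary using (¬_; yes; no)

module Sums {c ℓ} (R : Ring c ℓ) where
  open Ring R
  open import Relation.Binary.Reasoning.Setoid setoid
  open import Algebra.Solver.CommutativeMonoid +-commutativeMonoid using (solve; _⊕_; _⊜_)

  private variable A B : Set

  ∑ : List A → (A → Carrier) → Carrier
  ∑ xs f = sumR R (map f xs)

  ∑< : ℕ → (ℕ → Carrier) → Carrier
  ∑< n = ∑ (upTo n)

  ∑-cong : (xs : List A) {f g : A → Carrier} → (∀ a → f a ≈ g a) → ∑ xs f ≈ ∑ xs g
  ∑-cong []       f≈g = refl
  ∑-cong (a ∷ xs) f≈g = +-cong (f≈g a) (∑-cong xs f≈g)

  ∑-cong-All : {xs : List A} {f g : A → Carrier} → All (λ a → f a ≈ g a) xs → ∑ xs f ≈ ∑ xs g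
  ∑-cong-All []           = refl
  ∑-cong-All (fa≈ga ∷ eq) = +-cong fa≈ga (∑-cong-All eq)

  ∑-zero : (xs : List A) → ∑ xs (λ _ → 0#) ≈ 0#
  ∑-zero []       = refl
  ∑-zero (_ ∷ xs) = trans (+-identityˡ _) (∑-zero xs)

  ∑-++ : (xs ys : List A) (f : A → Carrier) → ∑ (xs ++ ys) f ≈ ∑ xs f + ∑ ys f
  ∑-++ []       ys f = sym (+-identityˡ _)
  ∑-++ (a ∷ xs) ys f = trans (+-cong refl (∑-++ xs ys f)) (sym (+-assoc _ _ _))

  ∑-distrib-+ : (xs : List A) (f g : A → Carrier) → ∑ xs (λ a → f a + g a) ≈ ∑ xs f + ∑ xs g
  ∑-distrib-+ []       f g = sym (+-identityˡ _)
  ∑-distrib-+ (a ∷ xs) f g = begin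
    (f a + g a) + ∑ xs (λ a → f a + g a) ≈⟨ +-cong refl (∑-distrib-+ xs f g) ⟩
    (f a + g a) + (∑ xs f + ∑ xs g)      ≈⟨ solve 4 (λ p q r s → (p ⊕ q) ⊕ (r ⊕ s) ⊜ (p ⊕ r) ⊕ (q ⊕ s)) refl _ _ _ _ ⟩
    (f a + ∑ xs f) + (g a + ∑ xs g)      ∎

  *-distribˡ-∑ : (k : Carrier) (xs : List A) (f : A → Carrier) → k * ∑ xs f ≈ ∑ xs (λ a → k * f a)
  *-distribˡ-∑ k []       f = zeroʳ k
  *-distribˡ-∑ k (a ∷ xs) f = trans (distribˡ _ _ _) (+-cong refl (*-distribˡ-∑ k xs f))

  *-distribʳ-∑ : (k : Carrier) (xs : List A) (f : A → Carrier) → ∑ xs f * k ≈ ∑ xs (λ a → f a * k)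
  *-distribʳ-∑ k []       f = zeroˡ k
  *-distribʳ-∑ k (a ∷ xs) f = trans (distribʳ _ _ _) (+-cong refl (*-distribʳ-∑ k xs f))

  ∑-comm : (xs : List A) (ys : List B) (f : A → B → Carrier) →
           ∑ xs (λ a → ∑ ys (f a)) ≈ ∑ ys (λ b → ∑ xs (λ a → f a b))
  ∑-comm []       ys f = sym (∑-zero ys)
  ∑-comm (a ∷ xs) ys f = trans (+-cong refl (∑-comm xs ys f)) (sym (∑-distrib-+ ys (f a) _))

  ∑-filterB : (p : A → Bool) (xs : List A) (f : A → Carrier) →
              ∑ (filterB p xs) f ≈ ∑ xs (λ a → if p a then f a else 0#)
  ∑-filterB p []       f = refl
  ∑-filterB p (a ∷ xs) f with p a
  ... | true  = +-cong refl (∑-filterB p xs f)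
  ... | false = trans (∑-filterB p xs f) (sym (+-identityˡ _))

  ∑-map : (g : A → B) (xs : List A) (f : B → Carrier) → ∑ (map g xs) f ≈ ∑ xs (f ∘ g)
  ∑-map g xs f = reflexive (≡.cong (sumR R) (≡.sym (List.map-∘ xs)))

  ∑-concatMap : (g : A → List B) (xs : List A) (f : B → Carrier) →
                ∑ (concatMap g xs) f ≈ ∑ xs (λ a → ∑ (g a) f)
  ∑-concatMap g []       f = refl
  ∑-concatMap g (a ∷ xs) f = trans (∑-++ (g a) (concatMap g xs) f) (+-cong refl (∑-concatMap g xs f))

  ∑<-cong : (n : ℕ) {f g : ℕ → Carrier} → (∀ {i} → i < n → f i ≈ g i) → ∑< n f ≈ ∑< n g
  ∑<-cong n f≈g = ∑-cong-All (All.applyUpTo⁺₁ Function.id n f≈g)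

  ∑<-suc : (n : ℕ) (f : ℕ → Carrier) → ∑< (suc n) f ≈ f 0 + ∑< n (f ∘ suc)
  ∑<-suc n f = +-cong refl (reflexive (≡.cong (sumR R)
    (≡.trans (List.map-applyUpTo suc f n) (≡.sym (List.map-upTo (f ∘ suc) n)))))

  ∑<-suc-last : (n : ℕ) (f : ℕ → Carrier) → ∑< (suc n) f ≈ ∑< n f + f n
  ∑<-suc-last n f = begin
    ∑ (upTo (suc n)) f       ≡⟨ ≡.cong (λ xs → ∑ xs f) (List.upTo-∷ʳ n) ⟨
    ∑ (upTo n ++ n ∷ []) f   ≈⟨ ∑-++ (upTo n) (n ∷ []) f ⟩
    ∑< n f + (f n + 0#)      ≈⟨ +-cong refl (+-identityʳ _) ⟩
    ∑< n f + f n             ∎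

  ∑-range : (a b : ℕ) (f : ℕ → Carrier) → ∑ (range a b) f ≈ ∑< (suc b ∸ a) (λ i → f (a ℕ.+ i))
  ∑-range a b f = ∑-map (a ℕ.+_) (upTo (suc b ∸ a)) f

  shift : (ℕ → Carrier) → ℕ → Carrier
  shift f zero    = 0#
  shift f (suc n) = f n

  ∑-shift : (xs : List A) (f : A → ℕ → Carrier) (n : ℕ) → ∑ xs (λ a → shift (f a) n) ≈ shift (λ m → ∑ xs (λ a → f a m)) n
  ∑-shift xs f zero    = ∑-zero xs
  ∑-shift xs f (suc n) = refl

  shift-cong : {f g : ℕ → Carrier} → (∀ m → f m ≈ g m) → ∀ n → shift f n ≈ shift g n
  shift-cong f≈g zero    = refl
  shift-cong f≈g (suc n) = f≈g n

  ∑₂ : ℕ → (ℕ → ℕ → Carrier) → Carrier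
  ∑₂ M h = ∑< (suc M) (λ t → h t (M ∸ t))

  ∑₃ : ℕ → (ℕ → ℕ → ℕ → Carrier) → Carrier
  ∑₃ L g = ∑< (suc L) (λ k → ∑₂ (L ∸ k) (g k))

  ∑₃-cong : ∀ L {g h : ℕ → ℕ → ℕ → Carrier} → (∀ k t f → g k t f ≈ h k t f) → ∑₃ L g ≈ ∑₃ L h
  ∑₃-cong L g≈h = ∑-cong (upTo (suc L)) (λ k → ∑-cong (upTo (suc (L ∸ k))) (λ t → g≈h k t (L ∸ k ∸ t)))

  ∑₃-distrib-+ : ∀ L (g h : ℕ → ℕ → ℕ → Carrier) → ∑₃ L (λ k t f → g k t f + h k t f) ≈ ∑₃ L g + ∑₃ L h
  ∑₃-distrib-+ L g h = trans (∑-cong (upTo (suc L)) (λ k → ∑-distrib-+ (upTo (suc (L ∸ k))) _ _))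
                             (∑-distrib-+ (upTo (suc L)) _ _)

  *-distribˡ-∑₃ : ∀ a L (g : ℕ → ℕ → ℕ → Carrier) → a * ∑₃ L g ≈ ∑₃ L (λ k t f → a * g k t f)
  *-distribˡ-∑₃ a L g = trans (*-distribˡ-∑ a (upTo (suc L)) _)
                              (∑-cong (upTo (suc L)) (λ k → *-distribˡ-∑ a (upTo (suc (L ∸ k))) _))

  ∑-∑₃-comm : (xs : List A) (L : ℕ) (g : A → ℕ → ℕ → ℕ → Carrier) →
              ∑ xs (λ a → ∑₃ L (g a)) ≈ ∑₃ L (λ k t f → ∑ xs (λ a → g a k t f))
  ∑-∑₃-comm xs L g = trans (∑-comm xs (upTo (suc L)) _)
                           (∑-cong (upTo (suc L)) (λ k → ∑-comm xs (upTo (suc (L ∸ k))) _))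

  ∑₃-suc-head : ∀ L (g : ℕ → ℕ → ℕ → Carrier) → ∑₃ (suc L) g ≈ ∑₂ (suc L) (g 0) + ∑₃ L (g ∘ suc)
  ∑₃-suc-head L g = ∑<-suc (suc L) _

  ∑₃-suc-slices : ∀ L (G g : ℕ → ℕ → ℕ → Carrier) →
    (∀ {k} → k ≤ L → ∑₂ (suc (L ∸ k)) (G k) ≈ ∑₂ (L ∸ k) (g k)) →
    ∑₂ 0 (G (suc L)) ≈ 0# → ∑₃ (suc L) G ≈ ∑₃ L g
  ∑₃-suc-slices L G g slice last = begin
    ∑₃ (suc L) G                                             ≈⟨ ∑<-suc-last (suc L) _ ⟩
    ∑< (suc L) (λ k → ∑₂ (suc L ∸ k) (G k)) + ∑₂ (L ∸ L) (G (suc L))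
      ≈⟨ +-cong (∑<-cong (suc L) (λ {k} k<sL → trans (reflexive (≡.cong (λ m → ∑₂ m (G k)) (ℕ.+-∸-assoc 1 (ℕ.≤-pred k<sL))))
                                                      (slice (ℕ.≤-pred k<sL))))
                (trans (reflexive (≡.cong (λ m → ∑₂ m (G (suc L))) (ℕ.n∸n≡0 L))) last) ⟩
    ∑₃ L g + 0#                                              ≈⟨ +-identityʳ _ ⟩
    ∑₃ L g                                                   ∎

  ∑₃-shift₂ : ∀ L (g : ℕ → ℕ → ℕ → Carrier) → ∑₃ (suc L) (λ k t f → shift (λ t′ → g k t′ f) t) ≈ ∑₃ L g
  ∑₃-shift₂ L g = ∑₃-suc-slices L (λ k t f → shift (λ t′ → g k t′ f) t) g (λ {k} _ → slice (L ∸ k) (g k)) (+-identityʳ _)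
    where
    slice : ∀ M (h : ℕ → ℕ → Carrier) → ∑₂ (suc M) (λ t f → shift (λ t′ → h t′ f) t) ≈ ∑₂ M h
    slice M h = trans (∑<-suc (suc M) (λ t → shift (λ t′ → h t′ (suc M ∸ t)) t)) (+-identityˡ _)

  ∑₃-shift₃ : ∀ L (g : ℕ → ℕ → ℕ → Carrier) → ∑₃ (suc L) (λ k t f → shift (g k t) f) ≈ ∑₃ L g
  ∑₃-shift₃ L g = ∑₃-suc-slices L (λ k t f → shift (g k t) f) g (λ {k} _ → slice (L ∸ k) (g k)) (+-identityʳ _)
    where
    slice : ∀ M (h : ℕ → ℕ → Carrier) → ∑₂ (suc M) (λ t f → shift (h t) f) ≈ ∑₂ M h
    slice M h = begin
      ∑< (suc (suc M)) (λ t → shift (h t) (suc M ∸ t))       ≈⟨ ∑<-suc-last (suc M) _ ⟩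
      ∑< (suc M) (λ t → shift (h t) (suc M ∸ t)) + shift (h (suc M)) (M ∸ M)
        ≈⟨ +-cong (∑<-cong (suc M) (λ {t} t<sM → reflexive (≡.cong (shift (h t)) (ℕ.+-∸-assoc 1 (ℕ.≤-pred t<sM)))))
                  (reflexive (≡.cong (shift (h (suc M))) (ℕ.n∸n≡0 M))) ⟩
      ∑₂ M h + 0#                                              ≈⟨ +-identityʳ _ ⟩
      ∑₂ M h                                                   ∎

  ∑<-triangle : ∀ N (F : ℕ → ℕ → Carrier) →
    ∑< N (λ k → ∑< (N ∸ k) (λ i → F k (k ℕ.+ i))) ≈ ∑< N (λ l → ∑< (suc l) (λ k → F k l))
  ∑<-triangle zero    F = refl
  ∑<-triangle (suc N) F = begin
    ∑< (suc N) (λ k → ∑< (suc N ∸ k) (λ i → F k (k ℕ.+ i)))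
      ≈⟨ ∑<-cong (suc N) (λ {k} k<sN → peel (ℕ.≤-pred k<sN)) ⟩
    ∑< (suc N) (λ k → ∑< (N ∸ k) (λ i → F k (k ℕ.+ i)) + F k N)
      ≈⟨ ∑-distrib-+ (upTo (suc N)) _ _ ⟩
    ∑< (suc N) (λ k → ∑< (N ∸ k) (λ i → F k (k ℕ.+ i))) + ∑< (suc N) (λ k → F k N)
      ≈⟨ +-cong (∑<-suc-last N _) refl ⟩
    ∑< N (λ k → ∑< (N ∸ k) (λ i → F k (k ℕ.+ i))) + ∑< (N ∸ N) (λ i → F N (N ℕ.+ i)) + ∑< (suc N) (λ k → F k N)
      ≈⟨ +-cong (+-cong (∑<-triangle N F) (reflexive (≡.cong (λ m → ∑< m (λ i → F N (N ℕ.+ i))) (ℕ.n∸n≡0 N)))) refl ⟩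
    ∑< N (λ l → ∑< (suc l) (λ k → F k l)) + 0# + ∑< (suc N) (λ k → F k N)
      ≈⟨ +-cong (+-identityʳ _) refl ⟩
    ∑< N (λ l → ∑< (suc l) (λ k → F k l)) + ∑< (suc N) (λ k → F k N)
      ≈⟨ ∑<-suc-last N _ ⟨
    ∑< (suc N) (λ l → ∑< (suc l) (λ k → F k l)) ∎
    where
    peel : ∀ {k} → k ≤ N → ∑< (suc N ∸ k) (λ i → F k (k ℕ.+ i)) ≈ ∑< (N ∸ k) (λ i → F k (k ℕ.+ i)) + F k N
    peel {k} k≤N = begin
      ∑< (suc N ∸ k) (λ i → F k (k ℕ.+ i))
        ≡⟨ ≡.cong (λ m → ∑< m (λ i → F k (k ℕ.+ i))) (ℕ.+-∸-assoc 1 k≤N) ⟩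
      ∑< (suc (N ∸ k)) (λ i → F k (k ℕ.+ i))
        ≈⟨ ∑<-suc-last (N ∸ k) _ ⟩
      ∑< (N ∸ k) (λ i → F k (k ℕ.+ i)) + F k (k ℕ.+ (N ∸ k))
        ≡⟨ ≡.cong (λ l → ∑< (N ∸ k) (λ i → F k (k ℕ.+ i)) + F k l) (ℕ.m+[n∸m]≡n k≤N) ⟩
      ∑< (N ∸ k) (λ i → F k (k ℕ.+ i)) + F k N ∎

module Combinatorics where
  open import Data.Nat using (_+_)
  open import Relation.Binary.PropositionalEquality

  ≡ᵇ-refl : ∀ n → (n ≡ᵇ n) ≡ true
  ≡ᵇ-refl zero    = refl
  ≡ᵇ-refl (suc n) = ≡ᵇ-refl n

  <⇒≢ᵇ : ∀ {m n} → m < n → (m ≡ᵇ n) ≡ false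
  <⇒≢ᵇ {zero}  {suc n} _         = refl
  <⇒≢ᵇ {suc m} {suc n} (s≤s m<n) = <⇒≢ᵇ m<n

  >⇒≢ᵇ : ∀ {m n} → m < n → (n ≡ᵇ m) ≡ false
  >⇒≢ᵇ {zero}  {suc n} _         = refl
  >⇒≢ᵇ {suc m} {suc n} (s≤s m<n) = >⇒≢ᵇ m<n

  <⇒<ᵇ : ∀ {m n} → m < n → (m <ᵇ n) ≡ true
  <⇒<ᵇ {zero}  {suc n} _         = refl
  <⇒<ᵇ {suc m} {suc n} (s≤s m<n) = <⇒<ᵇ m<n

  ≤⇒≮ᵇ : ∀ {m n} → m ≤ n → (n <ᵇ m) ≡ false
  ≤⇒≮ᵇ {zero}  {n}     _         = refl
  ≤⇒≮ᵇ {suc m} {suc n} (s≤s m≤n) = ≤⇒≮ᵇ m≤n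

  not-∨ : ∀ a b → not (a ∨ b) ≡ not a ∧ not b
  not-∨ true  b = refl
  not-∨ false b = refl

  module ∧-Solver = CommutativeMonoidSolver ∧-commutativeMonoid
  open ∧-Solver using (_⊕_; _⊜_)

  ∧-pull₄ : ∀ a b c d e f g h → a ∧ b ∧ c ∧ (h ∧ d) ∧ e ∧ f ∧ g ≡ h ∧ a ∧ b ∧ c ∧ d ∧ e ∧ f ∧ g
  ∧-pull₄ = ∧-Solver.solve 8 (λ a b c d e f g h →
    a ⊕ (b ⊕ (c ⊕ ((h ⊕ d) ⊕ (e ⊕ (f ⊕ g))))) ⊜ h ⊕ (a ⊕ (b ⊕ (c ⊕ (d ⊕ (e ⊕ (f ⊕ g))))))) refl

  ∧-pull₇ : ∀ a b c d e f g h → a ∧ b ∧ c ∧ d ∧ e ∧ f ∧ (h ∧ g) ≡ h ∧ a ∧ b ∧ c ∧ d ∧ e ∧ f ∧ g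
  ∧-pull₇ = ∧-Solver.solve 8 (λ a b c d e f g h →
    a ⊕ (b ⊕ (c ⊕ (d ⊕ (e ⊕ (f ⊕ (h ⊕ g)))))) ⊜ h ⊕ (a ⊕ (b ⊕ (c ⊕ (d ⊕ (e ⊕ (f ⊕ g))))))) refl

  _∈ᵇ_ : ℕ → List ℕ → Bool
  r ∈ᵇ rs = any (r ≡ᵇ_) rs

  module _ {A : Set} where

    any-map : {B : Set} (f : B → Bool) (g : A → B) (xs : List A) → any f (map g xs) ≡ any (f ∘ g) xs
    any-map f g xs = cong or (sym (List.map-∘ xs))

    any-cong : {f g : A → Bool} {xs : List A} → All (λ a → f a ≡ g a) xs → any f xs ≡ any g xs
    any-cong []       = refl
    any-cong (e ∷ es) = cong₂ _∨_ e (any-cong es)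

    any-false : {f : A → Bool} {xs : List A} → All (λ a → f a ≡ false) xs → any f xs ≡ false
    any-false []       = refl
    any-false (e ∷ es) rewrite e = any-false es

    filterB-++ : (p : A → Bool) (xs ys : List A) → filterB p (xs ++ ys) ≡ filterB p xs ++ filterB p ys
    filterB-++ p []       ys = refl
    filterB-++ p (x ∷ xs) ys with p x
    ... | true  = cong (x ∷_) (filterB-++ p xs ys)
    ... | false = filterB-++ p xs ys

    filterB-cong : {f g : A → Bool} {xs : List A} → All (λ a → f a ≡ g a) xs → filterB f xs ≡ filterB g xs
    filterB-cong                  []       = refl
    filterB-cong {f} {g} {x ∷ xs} (e ∷ es) with f x | g x | e
    ... | true  | .true  | refl = cong (x ∷_) (filterB-cong es)
    ... | false | .false | refl = filterB-cong es

    All-filterB : {P : A → Set} (p : A → Bool) {xs : List A} → All P xs → All P (filterB p xs)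
    All-filterB p []               = []
    All-filterB p {x ∷ xs} (px ∷ pxs) with p x
    ... | true  = px ∷ All-filterB p pxs
    ... | false = All-filterB p pxs

    countB-++ : (p : A → Bool) (xs ys : List A) → countB p (xs ++ ys) ≡ countB p xs + countB p ys
    countB-++ p xs ys = trans (cong length (filterB-++ p xs ys)) (List.length-++ (filterB p xs))

    countB-cong : {f g : A → Bool} {xs : List A} → All (λ a → f a ≡ g a) xs → countB f xs ≡ countB g xs
    countB-cong = cong length ∘ filterB-cong

  countB-∷ : ∀ {A : Set} (p : A → Bool) x xs → countB p (x ∷ xs) ≡ (if p x then 1 else 0) + countB p xs
  countB-∷ p x xs with p x
  ... | true  = refl
  ... | false = refl

  All-zip : ∀ {P : Cell → Set} (B : List Cell) (a : List Content) → All P B → All (P ∘ proj₁) (zip B a)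
  All-zip []      a       _          = []
  All-zip (_ ∷ B) []      _          = []
  All-zip (_ ∷ B) (_ ∷ a) (pc ∷ pcs) = pc ∷ All-zip B a pcs

  InColumn RightOf : ℕ → Cell → Set
  InColumn cx cell = proj₁ cell ≡ cx
  RightOf  cx cell = cx < proj₁ cell

  InRows : ℕ → ℕ → ℕ → Set
  InRows cy n r = cy ≤ r × r < cy + n

  InBlock : ℕ → ℕ → ℕ → Cell → Set
  InBlock cx cy n cell = RightOf cx cell × InRows cy n (proj₂ cell)

  InRows-suc : ∀ {cy n r} → InRows (suc cy) n r → InRows cy (suc n) r
  InRows-suc {cy} {n} {r} (cy<r , r<) = ℕ.<⇒≤ cy<r , subst (r <_) (sym (ℕ.+-suc cy n)) r<

  itemsOf : (Content → Bool) → Placement → List Cell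
  itemsOf P p = map proj₁ (filterB (P ∘ proj₂) p)

  itemsOf-++ : ∀ P p p′ → itemsOf P (p ++ p′) ≡ itemsOf P p ++ itemsOf P p′
  itemsOf-++ P p p′ = trans (cong (map proj₁) (filterB-++ (P ∘ proj₂) p p′)) (List.map-++ proj₁ (filterB (P ∘ proj₂) p) _)

  itemsOf-All : ∀ {Q : Cell → Set} P {p} → All (Q ∘ proj₁) p → All Q (itemsOf P p)
  itemsOf-All P qs = All.map⁺ (All-filterB (P ∘ proj₂) qs)

  column : ℕ → ℕ → ℕ → List Cell
  column cx cy zero    = []
  column cx cy (suc n) = (cx , cy) ∷ column cx (suc cy) n

  length-column : ∀ cx cy n → length (column cx cy n) ≡ n
  length-column cx cy zero    = refl
  length-column cx cy (suc n) = cong suc (length-column cx (suc cy) n)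

  onlyAt : ℕ → Content → ℕ → List Content
  onlyAt i       c zero    = []
  onlyAt zero    c (suc n) = c ∷ replicate n none
  onlyAt (suc i) c (suc n) = none ∷ onlyAt i c n

  module _ (P : Content → Bool) (P-none : P none ≡ false) (cx : ℕ) where

    itemsOf-emptyColumn : ∀ cy n → itemsOf P (zip (column cx cy n) (replicate n none)) ≡ []
    itemsOf-emptyColumn cy zero    = refl
    itemsOf-emptyColumn cy (suc n) rewrite P-none = itemsOf-emptyColumn (suc cy) n

    itemsOf-onlyAt : ∀ cy {i n} c → i < n →
      itemsOf P (zip (column cx cy n) (onlyAt i c n)) ≡ (if P c then (cx , cy + i) ∷ [] else [])
    itemsOf-onlyAt cy {zero} {suc n} c _ with P c
    ... | true  = cong₂ (λ r cells → (cx , r) ∷ cells) (sym (ℕ.+-identityʳ cy)) (itemsOf-emptyColumn (suc cy) n)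
    ... | false = itemsOf-emptyColumn (suc cy) n
    itemsOf-onlyAt cy {suc i} {suc n} c (s≤s i<n) rewrite P-none =
      trans (itemsOf-onlyAt (suc cy) c i<n) (cong (λ r → if P c then (cx , r) ∷ [] else []) (sym (ℕ.+-suc cy i)))

  itemsOf-column : ∀ P cx cy n a → All (InColumn cx) (itemsOf P (zip (column cx cy n) a))
  itemsOf-column P cx cy n a = itemsOf-All P (column-cells cy n a)
    where
    column-cells : ∀ cy n a → All (InColumn cx ∘ proj₁) (zip (column cx cy n) a)
    column-cells cy zero    a       = []
    column-cells cy (suc n) []      = []
    column-cells cy (suc n) (_ ∷ a) = refl ∷ column-cells (suc cy) n a

  occupied : List Content → ℕ
  occupied = countB (not ∘ isNone)

  rooks+files≡occupied : ∀ cx cy n a → length a ≡ n →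
    length (rooksOf (zip (column cx cy n) a)) + length (filesOf (zip (column cx cy n) a)) ≡ occupied a
  rooks+files≡occupied cx cy zero    []         _  = refl
  rooks+files≡occupied cx cy (suc n) (none ∷ a) eq = rooks+files≡occupied cx (suc cy) n a (ℕ.suc-injective eq)
  rooks+files≡occupied cx cy (suc n) (rook ∷ a) eq = cong suc (rooks+files≡occupied cx (suc cy) n a (ℕ.suc-injective eq))
  rooks+files≡occupied cx cy (suc n) (file ∷ a) eq =
    trans (ℕ.+-suc _ _) (cong suc (rooks+files≡occupied cx (suc cy) n a (ℕ.suc-injective eq)))

  shareColumn leftOf above : Cell → Cell → Bool
  shareColumn a b = proj₁ a ≡ᵇ proj₁ b
  leftOf      a b = (proj₂ a ≡ᵇ proj₂ b) ∧ (proj₁ a <ᵇ proj₁ b)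
  above       a b = (proj₁ a ≡ᵇ proj₁ b) ∧ (proj₂ b <ᵇ proj₂ a)

  clash blocked : List Cell → List Cell → Bool
  clash   F R = any (λ f → any (shareColumn f) R) F
  blocked F R = any (λ f → any (leftOf f) R) F

  -- validMixed k l p and emptyBoxes p unfold to validRF k l and emptyBoxesBy applied to rooksOf p and
  -- filesOf p; these versions let the two lists be rewritten independently of p.
  validRF : ℕ → ℕ → List Cell → List Cell → Bool
  validRF k l R F =
    (length R ≡ᵇ k) ∧ (length F ≡ᵇ l)
    ∧ noDup (map proj₁ R) ∧ noDup (map proj₂ R)
    ∧ noDup (map proj₁ F)
    ∧ not (clash F R)
    ∧ not (blocked F R)

  module _ {cx : ℕ} where

    ∉-RightOf : ∀ {cells} → All (RightOf cx) cells → cx ∈ᵇ map proj₁ cells ≡ false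
    ∉-RightOf {cells} gt = trans (any-map (cx ≡ᵇ_) proj₁ cells) (any-false (All.map <⇒≢ᵇ gt))

    clash-addRook : ∀ r {F} R → All (RightOf cx) F → clash F ((cx , r) ∷ R) ≡ clash F R
    clash-addRook r R F>cx = any-cong (All.map (λ {f} f>cx → cong (_∨ any (shareColumn f) R) (>⇒≢ᵇ f>cx)) F>cx)

    blocked-addRook : ∀ r {F} R → All (RightOf cx) F → blocked F ((cx , r) ∷ R) ≡ blocked F R
    blocked-addRook r R F>cx = any-cong (All.map (λ {f} f>cx → cong (_∨ any (leftOf f) R)
      (trans (cong ((proj₂ f ≡ᵇ r) ∧_) (≤⇒≮ᵇ (ℕ.<⇒≤ f>cx))) (∧-zeroʳ _))) F>cx)

    clash-addFile : ∀ r F {R} → All (RightOf cx) R → clash ((cx , r) ∷ F) R ≡ clash F R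
    clash-addFile r F {R} R>cx = cong (_∨ clash F R) (any-false (All.map <⇒≢ᵇ R>cx))

    leftOf-RightOf : ∀ r {R} → All (RightOf cx) R → any (leftOf (cx , r)) R ≡ r ∈ᵇ map proj₂ R
    leftOf-RightOf r {R} R>cx = begin
      any (leftOf (cx , r)) R
        ≡⟨ any-cong (All.map (λ {x} gt → trans (cong ((r ≡ᵇ proj₂ x) ∧_) (<⇒<ᵇ gt)) (∧-identityʳ _)) R>cx) ⟩
      any (λ x → r ≡ᵇ proj₂ x) R
        ≡⟨ any-map (r ≡ᵇ_) proj₂ R ⟨
      r ∈ᵇ map proj₂ R ∎
      where open ≡-Reasoning

    above-RightOf : ∀ r {cells} → All (RightOf cx) cells → any (above (cx , r)) cells ≡ false
    above-RightOf r gt = any-false (All.map (λ {x} gtₓ → cong (_∧ (proj₂ x <ᵇ r)) (<⇒≢ᵇ gtₓ)) gt)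

    blocked-addFile : ∀ r F {R} → All (RightOf cx) R → blocked ((cx , r) ∷ F) R ≡ r ∈ᵇ map proj₂ R ∨ blocked F R
    blocked-addFile r F {R} R>cx = cong (_∨ blocked F R) (leftOf-RightOf r R>cx)

    module _ {R F : List Cell} (R>cx : All (RightOf cx) R) (F>cx : All (RightOf cx) F) where

      valid-addRook : ∀ r k l → validRF (suc k) l ((cx , r) ∷ R) F ≡ not (r ∈ᵇ map proj₂ R) ∧ validRF k l R F
      valid-addRook r k l rewrite ∉-RightOf R>cx | clash-addRook r R F>cx | blocked-addRook r R F>cx =
        ∧-pull₄ (length R ≡ᵇ k) (length F ≡ᵇ l) (noDup (map proj₁ R)) (noDup (map proj₂ R)) (noDup (map proj₁ F))
                (not (clash F R)) (not (blocked F R)) (not (r ∈ᵇ map proj₂ R))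

      valid-addFile : ∀ r k l → validRF k (suc l) R ((cx , r) ∷ F) ≡ not (r ∈ᵇ map proj₂ R) ∧ validRF k l R F
      valid-addFile r k l
        rewrite ∉-RightOf F>cx | clash-addFile r F R>cx | blocked-addFile r F R>cx | not-∨ (r ∈ᵇ map proj₂ R) (blocked F R) =
        ∧-pull₇ (length R ≡ᵇ k) (length F ≡ᵇ l) (noDup (map proj₁ R)) (noDup (map proj₂ R)) (noDup (map proj₁ F))
                (not (clash F R)) (not (blocked F R)) (not (r ∈ᵇ map proj₂ R))

  valid-noFiles : ∀ k R f F → validRF k zero R (f ∷ F) ≡ false
  valid-noFiles k R f F = ∧-zeroʳ (length R ≡ᵇ k)

  module _ (k l : ℕ) (R F : List Cell) where

    valid⇒rookColumnsDistinct : T (validRF k l R F) → T (noDup (map proj₁ R))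
    valid⇒rookColumnsDistinct v with length R ≡ᵇ k | length F ≡ᵇ l | noDup (map proj₁ R)
    ... | true | true | true = _

    valid⇒fileColumnsDistinct : T (validRF k l R F) → T (noDup (map proj₁ F))
    valid⇒fileColumnsDistinct v
      with length R ≡ᵇ k | length F ≡ᵇ l | noDup (map proj₁ R) | noDup (map proj₂ R) | noDup (map proj₁ F)
    ... | true | true | true | true | true = _

    valid⇒noClash : T (validRF k l R F) → T (not (clash F R))
    valid⇒noClash v
      with length R ≡ᵇ k | length F ≡ᵇ l | noDup (map proj₁ R) | noDup (map proj₂ R) | noDup (map proj₁ F) | not (clash F R)
    ... | true | true | true | true | true | true = _

    valid⇒rookCount : T (validRF k l R F) → length R ≡ k
    valid⇒rookCount v with length R ≡ᵇ k in eq
    ... | true = ℕ.≡ᵇ⇒≡ (length R) k (subst T (sym eq) _)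

    valid⇒rookRowsDistinct : T (validRF k l R F) → T (noDup (map proj₂ R))
    valid⇒rookRowsDistinct v with length R ≡ᵇ k | length F ≡ᵇ l | noDup (map proj₁ R) | noDup (map proj₂ R)
    ... | true | true | true | true = _

  noDup-twice : ∀ c xs → T (noDup (c ∷ c ∷ xs)) → ⊥
  noDup-twice c xs nd rewrite ≡ᵇ-refl c = nd

  clash-sameColumn : ∀ {c} r₁ r₂ F R → T (not (clash ((c , r₂) ∷ F) ((c , r₁) ∷ R))) → ⊥
  clash-sameColumn {c} r₁ r₂ F R nc rewrite ≡ᵇ-refl c = nc

  valid⇒atMostOneInColumn : ∀ {cx} k l RC FC R F → All (InColumn cx) RC → All (InColumn cx) FC →
    T (validRF k l (RC ++ R) (FC ++ F)) → length RC + length FC ≤ 1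
  valid⇒atMostOneInColumn k l []       []       R F _ _ _ = z≤n
  valid⇒atMostOneInColumn k l []       (_ ∷ []) R F _ _ _ = s≤s z≤n
  valid⇒atMostOneInColumn k l (_ ∷ []) []       R F _ _ _ = s≤s z≤n
  valid⇒atMostOneInColumn {cx} k l ((.cx , r₁) ∷ (.cx , r₂) ∷ RC) FC R F (refl ∷ refl ∷ _) _ v =
    ⊥-elim (noDup-twice cx (map proj₁ (RC ++ R)) (valid⇒rookColumnsDistinct k l ((cx , r₁) ∷ (cx , r₂) ∷ RC ++ R) (FC ++ F) v))
  valid⇒atMostOneInColumn {cx} k l [] ((.cx , r₁) ∷ (.cx , r₂) ∷ FC) R F _ (refl ∷ refl ∷ _) v =
    ⊥-elim (noDup-twice cx (map proj₁ (FC ++ F)) (valid⇒fileColumnsDistinct k l R ((cx , r₁) ∷ (cx , r₂) ∷ FC ++ F) v))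
  valid⇒atMostOneInColumn {cx} k l ((.cx , r₁) ∷ RC) ((.cx , r₂) ∷ FC) R F (refl ∷ _) (refl ∷ _) v =
    ⊥-elim (clash-sameColumn r₁ r₂ (FC ++ F) (RC ++ R) (valid⇒noClash k l ((cx , r₁) ∷ RC ++ R) ((cx , r₂) ∷ FC ++ F) v))

  cancelledBy : List Cell → List Cell → Cell → Bool
  cancelledBy R F cell = any (above cell) R ∨ any (leftOf cell) R ∨ any (above cell) F

  emptyBoxesBy : List Cell → List Cell → Placement → ℕ
  emptyBoxesBy R F = countB (λ e → isNone (proj₂ e) ∧ not (cancelledBy R F (proj₁ e)))

  freeCells : (ℕ → Bool) → ℕ → ℕ → List Content → ℕ
  freeCells g cy zero    a       = 0
  freeCells g cy (suc n) []      = 0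
  freeCells g cy (suc n) (c ∷ a) = (if isNone c ∧ not (g cy) then 1 else 0) + freeCells g (suc cy) n a

  freeRows : List ℕ → ℕ → ℕ → ℕ
  freeRows rs cy n = freeCells (_∈ᵇ rs) cy n (replicate n none)

  module _ {cx : ℕ} where

    cancelled-addRook : ∀ r₀ R F cell → RightOf cx cell → cancelledBy ((cx , r₀) ∷ R) F cell ≡ cancelledBy R F cell
    cancelled-addRook r₀ R F (c , r) gt rewrite >⇒≢ᵇ gt | ≤⇒≮ᵇ (ℕ.<⇒≤ gt) | ∧-zeroʳ (r ≡ᵇ r₀) = refl

    cancelled-addFile : ∀ r₀ R F cell → RightOf cx cell → cancelledBy R ((cx , r₀) ∷ F) cell ≡ cancelledBy R F cell
    cancelled-addFile r₀ R F (c , r) gt rewrite >⇒≢ᵇ gt = refl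

    emptyBoxesBy-addRook : ∀ r₀ R F {p} → All (RightOf cx ∘ proj₁) p → emptyBoxesBy ((cx , r₀) ∷ R) F p ≡ emptyBoxesBy R F p
    emptyBoxesBy-addRook r₀ R F gt =
      countB-cong (All.map (λ {e} gtₑ → cong (λ b → isNone (proj₂ e) ∧ not b) (cancelled-addRook r₀ R F (proj₁ e) gtₑ)) gt)

    emptyBoxesBy-addFile : ∀ r₀ R F {p} → All (RightOf cx ∘ proj₁) p → emptyBoxesBy R ((cx , r₀) ∷ F) p ≡ emptyBoxesBy R F p
    emptyBoxesBy-addFile r₀ R F gt =
      countB-cong (All.map (λ {e} gtₑ → cong (λ b → isNone (proj₂ e) ∧ not b) (cancelled-addFile r₀ R F (proj₁ e) gtₑ)) gt)

    module _ {R F : List Cell} (R>cx : All (RightOf cx) R) (F>cx : All (RightOf cx) F) where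

      cancelled-column : ∀ r → cancelledBy R F (cx , r) ≡ r ∈ᵇ map proj₂ R
      cancelled-column r rewrite above-RightOf r R>cx | leftOf-RightOf r R>cx | above-RightOf r F>cx = ∨-identityʳ _

      cancelled-column-rook : ∀ r₀ r → cancelledBy ((cx , r₀) ∷ R) F (cx , r) ≡ r ∈ᵇ map proj₂ R ∨ (r₀ <ᵇ r)
      cancelled-column-rook r₀ r
        rewrite ≡ᵇ-refl cx | ≤⇒≮ᵇ (ℕ.≤-refl {cx}) | ∧-zeroʳ (r ≡ᵇ r₀)
              | above-RightOf r R>cx | leftOf-RightOf r R>cx | above-RightOf r F>cx
              | ∨-identityʳ (r₀ <ᵇ r) | ∨-identityʳ (r ∈ᵇ map proj₂ R) = ∨-comm (r₀ <ᵇ r) (r ∈ᵇ map proj₂ R)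

      cancelled-column-file : ∀ r₀ r → cancelledBy R ((cx , r₀) ∷ F) (cx , r) ≡ r ∈ᵇ map proj₂ R ∨ (r₀ <ᵇ r)
      cancelled-column-file r₀ r
        rewrite ≡ᵇ-refl cx | above-RightOf r R>cx | leftOf-RightOf r R>cx | above-RightOf r F>cx | ∨-identityʳ (r₀ <ᵇ r) = refl

    emptyBoxesBy-column : ∀ R F {g} → (∀ r → cancelledBy R F (cx , r) ≡ g r) →
      ∀ cy n a → emptyBoxesBy R F (zip (column cx cy n) a) ≡ freeCells g cy n a
    emptyBoxesBy-column R F eq cy zero    a       = refl
    emptyBoxesBy-column R F eq cy (suc n) []      = refl
    emptyBoxesBy-column R F eq cy (suc n) (c ∷ a) =
      trans (countB-∷ (λ e → isNone (proj₂ e) ∧ not (cancelledBy R F (proj₁ e))) ((cx , cy) , c) (zip (column cx (suc cy) n) a))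
            (cong₂ (λ b m → (if isNone c ∧ not b then 1 else 0) + m) (eq cy) (emptyBoxesBy-column R F eq (suc cy) n a))

  freeCells-cong : ∀ {g h} cy n → (∀ {r} → cy ≤ r → g r ≡ h r) →
    freeCells g cy n (replicate n none) ≡ freeCells h cy n (replicate n none)
  freeCells-cong cy zero    eq = refl
  freeCells-cong cy (suc n) eq =
    cong₂ (λ b m → (if not b then 1 else 0) + m) (eq ℕ.≤-refl) (freeCells-cong (suc cy) n (eq ∘ ℕ.<⇒≤))

  freeCells-allCancelled : ∀ {g} cy n → (∀ {r} → cy ≤ r → g r ≡ true) → freeCells g cy n (replicate n none) ≡ 0
  freeCells-allCancelled cy zero    eq = refl
  freeCells-allCancelled cy (suc n) eq rewrite eq (ℕ.≤-refl {cy}) = freeCells-allCancelled (suc cy) n (eq ∘ ℕ.<⇒≤)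

  freeCells-onlyAt : ∀ rs {r₀ c} cy {i n} → isNone c ≡ false → cy + i ≡ r₀ → i < n →
    freeCells (λ r → r ∈ᵇ rs ∨ (r₀ <ᵇ r)) cy n (onlyAt i c n) ≡ freeRows rs cy i
  freeCells-onlyAt rs {r₀} cy {zero} {suc n} c≢none refl _ rewrite c≢none =
    freeCells-allCancelled (suc cy) n (λ {r} cy<r →
      trans (cong (r ∈ᵇ rs ∨_) (<⇒<ᵇ (subst (_< r) (sym (ℕ.+-identityʳ cy)) cy<r))) (∨-zeroʳ _))
  freeCells-onlyAt rs {r₀} cy {suc i} {suc n} c≢none refl (s≤s i<n) =
    cong₂ (λ b m → (if not b then 1 else 0) + m)
      (trans (cong (cy ∈ᵇ rs ∨_) (≤⇒≮ᵇ (ℕ.m≤m+n cy (suc i)))) (∨-identityʳ _))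
      (freeCells-onlyAt rs (suc cy) c≢none (sym (ℕ.+-suc cy i)) i<n)

  freeRows-[] : ∀ cy n → freeRows [] cy n ≡ n
  freeRows-[] cy zero    = refl
  freeRows-[] cy (suc n) = cong suc (freeRows-[] (suc cy) n)

  freeRows-∷ : ∀ r rs cy n → InRows cy n r → r ∈ᵇ rs ≡ false → suc (freeRows (r ∷ rs) cy n) ≡ freeRows rs cy n
  freeRows-∷ r rs cy zero (cy≤r , r<cy+0) _ =
    ⊥-elim (ℕ.<-irrefl refl (ℕ.≤-trans r<cy+0 (subst (_≤ r) (sym (ℕ.+-identityʳ cy)) cy≤r)))
  freeRows-∷ r rs cy (suc n) (cy≤r , r<cy+n) r∉rs with ℕ.m≤n⇒m<n∨m≡n cy≤r
  ... | inj₂ refl rewrite ≡ᵇ-refl r | r∉rs =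
    cong suc (freeCells-cong (suc r) n (λ {r′} r<r′ → cong (_∨ r′ ∈ᵇ rs) (>⇒≢ᵇ r<r′)))
  ... | inj₁ cy<r rewrite <⇒≢ᵇ cy<r =
    trans (sym (ℕ.+-suc _ _)) (cong (_ +_) (freeRows-∷ r rs (suc cy) n (cy<r , subst (r <_) (ℕ.+-suc cy n) r<cy+n) r∉rs))

  freeRows+length : ∀ rs cy n → T (noDup rs) → All (InRows cy n) rs → freeRows rs cy n + length rs ≡ n
  freeRows+length []       cy n _  _          = trans (ℕ.+-identityʳ _) (freeRows-[] cy n)
  freeRows+length (r ∷ rs) cy n nd (r∈ ∷ rs∈) with r ∈ᵇ rs in r∉rs
  ... | false = begin
    freeRows (r ∷ rs) cy n + suc (length rs) ≡⟨ ℕ.+-suc _ (length rs) ⟩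
    suc (freeRows (r ∷ rs) cy n) + length rs ≡⟨ cong (_+ length rs) (freeRows-∷ r rs cy n r∈ r∉rs) ⟩
    freeRows rs cy n + length rs             ≡⟨ freeRows+length rs cy n nd rs∈ ⟩
    n                                        ∎
    where open ≡-Reasoning

  freeRows-count : ∀ rs cy n → T (noDup rs) → All (InRows cy n) rs → freeRows rs cy n ≡ n ∸ length rs
  freeRows-count rs cy n nd rs∈ =
    trans (sym (ℕ.m+n∸n≡m _ (length rs))) (cong (_∸ length rs) (freeRows+length rs cy n nd rs∈))

  #X #Y : Word → ℕ
  #X []      = 0
  #X (X ∷ w) = suc (#X w)
  #X (Y ∷ w) = #X w
  #Y []      = 0
  #Y (X ∷ w) = #Y w
  #Y (Y ∷ w) = suc (#Y w)

  yRows≡column : ∀ cx cy w → map (cx ,_) (yRows cy w) ≡ column cx cy (#Y w)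
  yRows≡column cx cy []      = refl
  yRows≡column cx cy (X ∷ w) = yRows≡column cx cy w
  yRows≡column cx cy (Y ∷ w) = cong ((cx , cy) ∷_) (yRows≡column cx (suc cy) w)

  board′-X : ∀ cx cy w → board' cx cy (X ∷ w) ≡ column cx cy (#Y w) ++ board' (suc cx) cy w
  board′-X cx cy w = cong (_++ board' (suc cx) cy w) (yRows≡column cx cy w)

  column-inBlock : ∀ cx cy n → All (InBlock cx cy n) (column (suc cx) cy n)
  column-inBlock cx cy zero    = []
  column-inBlock cx cy (suc n) = (ℕ.≤-refl , ℕ.≤-refl , subst (cy <_) (sym (ℕ.+-suc cy n)) (s≤s (ℕ.m≤m+n cy n)))
                                 ∷ All.map (λ { (cx< , inRows) → cx< , InRows-suc inRows }) (column-inBlock cx (suc cy) n)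

  board′-inBlock : ∀ cx cy w → All (InBlock cx cy (#Y w)) (board' (suc cx) cy w)
  board′-inBlock cx cy []      = []
  board′-inBlock cx cy (X ∷ w) rewrite board′-X (suc cx) cy w =
    All.++⁺ (column-inBlock cx cy (#Y w))
            (All.map (λ { (cx< , inRows) → ℕ.<⇒≤ cx< , inRows }) (board′-inBlock (suc cx) cy w))
  board′-inBlock cx cy (Y ∷ w) = All.map (λ { (cx< , inRows) → cx< , InRows-suc inRows }) (board′-inBlock cx (suc cy) w)

  largestPart : List ℕ → ℕ
  largestPart []      = 0
  largestPart (a ∷ _) = a

  omega-∷ : ∀ a ps → omega (a ∷ ps) ≡ X ∷ (replicate (a ∸ largestPart ps) Y ++ omega ps)
  omega-∷ a []       = cong (X ∷_) (sym (List.++-identityʳ (replicate a Y)))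
  omega-∷ a (b ∷ ps) = refl

  #X-++ : ∀ u v → #X (u ++ v) ≡ #X u + #X v
  #X-++ []      v = refl
  #X-++ (X ∷ u) v = cong suc (#X-++ u v)
  #X-++ (Y ∷ u) v = #X-++ u v

  #Y-++ : ∀ u v → #Y (u ++ v) ≡ #Y u + #Y v
  #Y-++ []      v = refl
  #Y-++ (X ∷ u) v = #Y-++ u v
  #Y-++ (Y ∷ u) v = cong suc (#Y-++ u v)

  #X-Yʲ : ∀ j → #X (replicate j Y) ≡ 0
  #X-Yʲ zero    = refl
  #X-Yʲ (suc j) = #X-Yʲ j

  #Y-Yʲ : ∀ j → #Y (replicate j Y) ≡ j
  #Y-Yʲ zero    = refl
  #Y-Yʲ (suc j) = cong suc (#Y-Yʲ j)

  Shape : ℕ → ℕ → List ℕ → Set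
  Shape a l ps = #X (omega ps) ≡ l × #Y (omega ps) ≡ largestPart ps × largestPart ps ≤ a

  omega-shape : ∀ a l → All (Shape a l) (partsBox a l)
  omega-shape a zero    = (refl , refl , z≤n) ∷ []
  omega-shape a (suc l) = All.concat⁺ (All.map⁺ (All.applyUpTo⁺₁ Function.id (suc a) (λ {j} j<sa →
      All.map⁺ (All.map (λ {ps} → shape-∷ {j} {ps} (ℕ.≤-pred j<sa)) (omega-shape j l)))))
    where
    shape-∷ : ∀ {j ps} → j ≤ a → Shape j l ps → Shape a (suc l) (j ∷ ps)
    shape-∷ {j} {ps} j≤a (xs≡l , ys≡h , h≤j) rewrite omega-∷ j ps =
        cong suc (trans (#X-++ (replicate (j ∸ largestPart ps) Y) (omega ps)) (cong₂ _+_ (#X-Yʲ (j ∸ largestPart ps)) xs≡l))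
      , trans (#Y-++ (replicate (j ∸ largestPart ps) Y) (omega ps))
              (trans (cong₂ _+_ (#Y-Yʲ (j ∸ largestPart ps)) ys≡h) (ℕ.m∸n+n≡m h≤j))
      , j≤a

open Combinatorics

module RookSums {c ℓ} (R : Ring c ℓ) (q : Ring.Carrier R) where
  open Ring R hiding (zero)
  open Sums R
  open import Relation.Binary.Reasoning.Setoid setoid
  open import Algebra.Solver.CommutativeMonoid +-commutativeMonoid using (solve; _⊕_; _⊜_; id)

  infixr 8 _^_
  _^_ : Carrier → ℕ → Carrier
  _^_ = pow R

  ^-+ : ∀ x a b → x ^ (a ℕ.+ b) ≈ x ^ a * x ^ b
  ^-+ x zero    b = sym (*-identityˡ _)
  ^-+ x (suc a) b = trans (*-cong refl (^-+ x a b)) (sym (*-assoc _ _ _))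

  [_]q : ℕ → Carrier
  [ zero  ]q = 0#
  [ suc n ]q = 1# + q * [ n ]q

  addColumn : ℕ → (ℕ → ℕ → Carrier) → ℕ → ℕ → Carrier
  addColumn n G k l = q ^ (n ∸ k) * G k l + (shift (λ k′ → [ n ∸ k′ ]q * G k′ l) k + shift (λ l′ → [ n ∸ k ]q * G k l′) l)

  addColumn-cong : ∀ n {G H : ℕ → ℕ → Carrier} → (∀ k l → G k l ≈ H k l) → ∀ k l → addColumn n G k l ≈ addColumn n H k l
  addColumn-cong n G≈H k l = +-cong (*-cong refl (G≈H k l))
    (+-cong (shift-cong (λ k′ → *-cong refl (G≈H k′ l)) k) (shift-cong (λ l′ → *-cong refl (G≈H k l′)) l))

  ∑-addColumn : ∀ {A : Set} (xs : List A) n (G : A → ℕ → ℕ → Carrier) k l →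
    ∑ xs (λ a → addColumn n (G a) k l) ≈ addColumn n (λ k l → ∑ xs (λ a → G a k l)) k l
  ∑-addColumn xs n G k l = begin
    ∑ xs (λ a → addColumn n (G a) k l)
      ≈⟨ trans (∑-distrib-+ xs _ _) (+-cong refl (∑-distrib-+ xs _ _)) ⟩
    ∑ xs (λ a → q ^ (n ∸ k) * G a k l)
      + (∑ xs (λ a → shift (λ k′ → [ n ∸ k′ ]q * G a k′ l) k) + ∑ xs (λ a → shift (λ l′ → [ n ∸ k ]q * G a k l′) l))
      ≈⟨ +-cong (sym (*-distribˡ-∑ _ xs _))
                (+-cong (trans (∑-shift xs (λ a k′ → [ n ∸ k′ ]q * G a k′ l) k)
                               (shift-cong (λ k′ → sym (*-distribˡ-∑ _ xs _)) k))
                        (trans (∑-shift xs (λ a l′ → [ n ∸ k ]q * G a k l′) l)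
                               (shift-cong (λ l′ → sym (*-distribˡ-∑ _ xs _)) l))) ⟩
    addColumn n (λ k l → ∑ xs (λ a → G a k l)) k l ∎

  weightBy : ℕ → ℕ → List Cell → List Cell → Placement → Carrier
  weightBy k l Rs Fs p = if validRF k l Rs Fs then q ^ emptyBoxesBy Rs Fs p else 0#

  weight : ℕ → ℕ → Placement → Carrier
  weight k l p = weightBy k l (rooksOf p) (filesOf p) p

  rookSum : ℕ → ℕ → List Cell → Carrier
  rookSum k l B = ∑ (mixedPlacements k l B) (λ φ → q ^ emptyBoxes φ)

  rookSum≈∑weight : ∀ k l B → rookSum k l B ≈ ∑ (assignments (length B)) (λ a → weight k l (zip B a))
  rookSum≈∑weight k l B = trans (∑-filterB (validMixed k l) (map (zip B) (assignments (length B))) (λ φ → q ^ emptyBoxes φ))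
                                 (∑-map (zip B) (assignments (length B)) _)

  weight-invalid : ∀ k l p → ¬ T (validMixed k l p) → weight k l p ≈ 0#
  weight-invalid k l p ¬v with validMixed k l p
  ... | true  = ⊥-elim (¬v _)
  ... | false = refl

  assignments-length : ∀ n → All (λ a → length a ≡ n) (assignments n)
  assignments-length zero    = ≡.refl ∷ []
  assignments-length (suc n) =
    All.concat⁺ (All.map⁺ {xs = none ∷ rook ∷ file ∷ []} {f = λ c → map (c ∷_) (assignments n)}
                          (extend none ∷ extend rook ∷ extend file ∷ []))
    where
    extend : ∀ c → All (λ a → length a ≡ suc n) (map (c ∷_) (assignments n))
    extend c = All.map⁺ (All.map (≡.cong suc) (assignments-length n))

  ∑-assignments-suc : ∀ n (h : List Content → Carrier) → ∑ (assignments (suc n)) h ≈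
    ∑ (assignments n) (h ∘ (none ∷_)) + (∑ (assignments n) (h ∘ (rook ∷_)) + (∑ (assignments n) (h ∘ (file ∷_)) + 0#))
  ∑-assignments-suc n h = trans (∑-concatMap (λ c → map (c ∷_) (assignments n)) (none ∷ rook ∷ file ∷ []) h)
    (+-cong (∑-map (none ∷_) (assignments n) h) (+-cong (∑-map (rook ∷_) (assignments n) h)
      (+-cong (∑-map (file ∷_) (assignments n) h) refl)))

  ∑-assignments-zip-++ : ∀ (C B : List Cell) (h : Placement → Carrier) →
    ∑ (assignments (length (C ++ B))) (λ v → h (zip (C ++ B) v)) ≈
    ∑ (assignments (length C)) (λ a → ∑ (assignments (length B)) (λ b → h (zip C a ++ zip B b)))
  ∑-assignments-zip-++ []      B h = sym (+-identityʳ _)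
  ∑-assignments-zip-++ (x ∷ C) B h =
    trans (∑-assignments-suc (length (C ++ B)) _)
          (trans (+-cong (split none) (+-cong (split rook) (+-cong (split file) refl)))
                 (sym (∑-assignments-suc (length C) _)))
    where
    split : ∀ c → ∑ (assignments (length (C ++ B))) (λ v → h ((x , c) ∷ zip (C ++ B) v)) ≈
                  ∑ (assignments (length C)) (λ a → ∑ (assignments (length B)) (λ b → h ((x , c) ∷ zip C a ++ zip B b)))
    split c = ∑-assignments-zip-++ C B (λ p → h ((x , c) ∷ p))

  ∑-assignments-zero : ∀ n (h : List Content → Carrier) → (∀ a → length a ≡ n → h a ≈ 0#) → ∑ (assignments n) h ≈ 0#
  ∑-assignments-zero n h h≈0 = trans (∑-cong-All (All.map (h≈0 _) (assignments-length n))) (∑-zero (assignments n))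

  ∑-assignments-unoccupied : ∀ n (h : List Content → Carrier) → (∀ a → length a ≡ n → 1 ≤ occupied a → h a ≈ 0#) →
    ∑ (assignments n) h ≈ h (replicate n none)
  ∑-assignments-unoccupied zero    h h≈0 = +-identityʳ _
  ∑-assignments-unoccupied (suc n) h h≈0 = begin
    ∑ (assignments (suc n)) h
      ≈⟨ ∑-assignments-suc n h ⟩
    ∑ (assignments n) (h ∘ (none ∷_)) + (∑ (assignments n) (h ∘ (rook ∷_)) + (∑ (assignments n) (h ∘ (file ∷_)) + 0#))
      ≈⟨ +-cong (∑-assignments-unoccupied n (h ∘ (none ∷_)) (λ a len → h≈0 (none ∷ a) (≡.cong suc len)))
                (+-cong (∑-assignments-zero n (h ∘ (rook ∷_)) (λ a len → h≈0 (rook ∷ a) (≡.cong suc len) (s≤s z≤n)))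
                        (+-cong (∑-assignments-zero n (h ∘ (file ∷_)) (λ a len → h≈0 (file ∷ a) (≡.cong suc len) (s≤s z≤n)))
                                refl)) ⟩
    h (replicate (suc n) none) + (0# + (0# + 0#))
      ≈⟨ trans (+-cong refl (trans (+-identityˡ _) (+-identityˡ _))) (+-identityʳ _) ⟩
    h (replicate (suc n) none) ∎

  ∑-assignments-atMostOne : ∀ n (h : List Content → Carrier) → (∀ a → length a ≡ n → 2 ≤ occupied a → h a ≈ 0#) →
    ∑ (assignments n) h ≈ h (replicate n none) + (∑< n (λ i → h (onlyAt i rook n)) + ∑< n (λ i → h (onlyAt i file n)))
  ∑-assignments-atMostOne zero    h h≈0 = trans (+-identityʳ _) (sym (trans (+-cong refl (+-identityʳ _)) (+-identityʳ _)))
  ∑-assignments-atMostOne (suc n) h h≈0 = begin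
    ∑ (assignments (suc n)) h
      ≈⟨ ∑-assignments-suc n h ⟩
    ∑ (assignments n) (h ∘ (none ∷_)) + (∑ (assignments n) (h ∘ (rook ∷_)) + (∑ (assignments n) (h ∘ (file ∷_)) + 0#))
      ≈⟨ +-cong (∑-assignments-atMostOne n (h ∘ (none ∷_)) (λ a len → h≈0 (none ∷ a) (≡.cong suc len)))
                (+-cong (∑-assignments-unoccupied n (h ∘ (rook ∷_)) (λ a len occ → h≈0 (rook ∷ a) (≡.cong suc len) (s≤s occ)))
                        (+-cong (∑-assignments-unoccupied n (h ∘ (file ∷_))
                                                           (λ a len occ → h≈0 (file ∷ a) (≡.cong suc len) (s≤s occ)))
                                refl)) ⟩
    h₀ + (∑< n (rookAt ∘ suc) + ∑< n (fileAt ∘ suc)) + (rookAt 0 + (fileAt 0 + 0#))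
      ≈⟨ solve 5 (λ a b c d e → (a ⊕ (b ⊕ c)) ⊕ (d ⊕ (e ⊕ id)) ⊜ a ⊕ ((d ⊕ b) ⊕ (e ⊕ c))) refl _ _ _ _ _ ⟩
    h₀ + ((rookAt 0 + ∑< n (rookAt ∘ suc)) + (fileAt 0 + ∑< n (fileAt ∘ suc)))
      ≈⟨ +-cong refl (+-cong (∑<-suc n rookAt) (∑<-suc n fileAt)) ⟨
    h₀ + (∑< (suc n) rookAt + ∑< (suc n) fileAt) ∎
    where
    h₀ : Carrier
    h₀ = h (replicate (suc n) none)
    rookAt fileAt : ℕ → Carrier
    rookAt i = h (onlyAt i rook (suc n))
    fileAt i = h (onlyAt i file (suc n))

  rowWeight : List ℕ → ℕ → ℕ → Carrier
  rowWeight rs cy i = if not ((cy ℕ.+ i) ∈ᵇ rs) then q ^ freeRows rs cy i else 0#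

  ∑-rowWeight : ∀ rs cy n → ∑< n (rowWeight rs cy) ≈ [ freeRows rs cy n ]q
  ∑-rowWeight rs cy zero    = refl
  ∑-rowWeight rs cy (suc n) = begin
    ∑< (suc n) (rowWeight rs cy)
      ≈⟨ ∑<-suc n (rowWeight rs cy) ⟩
    rowWeight rs cy 0 + ∑< n (rowWeight rs cy ∘ suc)
      ≈⟨ +-cong (reflexive (≡.cong (λ r → if not (r ∈ᵇ rs) then 1# else 0#) (ℕ.+-identityʳ cy)))
                (∑<-cong n (λ {i} _ →
                   reflexive (≡.cong (λ r → if not (r ∈ᵇ rs) then q ^ freeRows rs cy (suc i) else 0#) (ℕ.+-suc cy i)))) ⟩
    (if not (cy ∈ᵇ rs) then 1# else 0#) + ∑< n (λ i → if not ((suc cy ℕ.+ i) ∈ᵇ rs) then q ^ freeRows rs cy (suc i) else 0#)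
      ≈⟨ split (cy ∈ᵇ rs) ⟩
    [ freeRows rs cy (suc n) ]q ∎
    where
    split : ∀ b →
      (if not b then 1# else 0#)
        + ∑< n (λ i → if not ((suc cy ℕ.+ i) ∈ᵇ rs) then q ^ ((if not b then 1 else 0) ℕ.+ freeRows rs (suc cy) i) else 0#)
      ≈ [ (if not b then 1 else 0) ℕ.+ freeRows rs (suc cy) n ]q
    split true  = trans (+-identityˡ _) (∑-rowWeight rs (suc cy) n)
    split false = +-cong refl (begin
      ∑< n (λ i → if not ((suc cy ℕ.+ i) ∈ᵇ rs) then q * q ^ freeRows rs (suc cy) i else 0#)
        ≈⟨ ∑<-cong n (λ {i} _ → q*-if (not ((suc cy ℕ.+ i) ∈ᵇ rs))) ⟩
      ∑< n (λ i → q * rowWeight rs (suc cy) i)  ≈⟨ *-distribˡ-∑ q (upTo n) (rowWeight rs (suc cy)) ⟨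
      q * ∑< n (rowWeight rs (suc cy))          ≈⟨ *-cong refl (∑-rowWeight rs (suc cy) n) ⟩
      q * [ freeRows rs (suc cy) n ]q           ∎)
      where
      q*-if : ∀ b {x} → (if b then q * x else 0#) ≈ q * (if b then x else 0#)
      q*-if true  = refl
      q*-if false = sym (zeroʳ q)

  weight-split : ∀ a b m e → (if a ∧ b then q ^ (m ℕ.+ e) else 0#) ≈ (if a then q ^ m else 0#) * (if b then q ^ e else 0#)
  weight-split true  true  m e = ^-+ q m e
  weight-split true  false m e = sym (zeroʳ _)
  weight-split false b     m e = sym (zeroˡ _)

  module Column (cx cy n : ℕ) (p′ : Placement)
                (p′-right : All (RightOf cx ∘ proj₁) p′) (p′-rows : All (InRows cy n ∘ proj₂ ∘ proj₁) p′) where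

    C Rs Fs : List Cell
    C  = column cx cy n
    Rs = rooksOf p′
    Fs = filesOf p′

    Rs-right : All (RightOf cx) Rs
    Rs-right = itemsOf-All isRook p′-right

    Fs-right : All (RightOf cx) Fs
    Fs-right = itemsOf-All isFile p′-right

    rows : List ℕ
    rows = map proj₂ Rs

    freeRows-valid : ∀ k l → T (validMixed k l p′) → freeRows rows cy n ≡ n ∸ k
    freeRows-valid k l v =
      ≡.trans (freeRows-count rows cy n (valid⇒rookRowsDistinct k l Rs Fs v) rows-in-range)
              (≡.cong (n ∸_) (≡.trans (List.length-map proj₂ Rs) (valid⇒rookCount k l Rs Fs v)))
      where
      rows-in-range : All (InRows cy n) rows
      rows-in-range = All.map⁺ (itemsOf-All {Q = InRows cy n ∘ proj₂} isRook p′-rows)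

    weight-column : ∀ k l a {RC FC v e₁ e₂} → rooksOf (zip C a) ≡ RC → filesOf (zip C a) ≡ FC →
      validRF k l (RC ++ Rs) (FC ++ Fs) ≡ v →
      emptyBoxesBy (RC ++ Rs) (FC ++ Fs) (zip C a) ≡ e₁ → emptyBoxesBy (RC ++ Rs) (FC ++ Fs) p′ ≡ e₂ →
      weight k l (zip C a ++ p′) ≡ (if v then q ^ (e₁ ℕ.+ e₂) else 0#)
    weight-column k l a {RC} {FC} ≡.refl ≡.refl valid boxes₁ boxes₂ =
      ≡.trans (≡.cong₂ (λ R′ F′ → weightBy k l R′ F′ (zip C a ++ p′))
                       (itemsOf-++ isRook (zip C a) p′) (itemsOf-++ isFile (zip C a) p′))
              (≡.cong₂ (λ v e → if v then q ^ e else 0#) valid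
                       (≡.trans (countB-++ _ (zip C a) p′) (≡.cong₂ ℕ._+_ boxes₁ boxes₂)))

    weight-emptyColumn : ∀ k l → weight k l (zip C (replicate n none) ++ p′) ≈ q ^ (n ∸ k) * weight k l p′
    weight-emptyColumn k l = trans
      (reflexive (weight-column k l (replicate n none) (itemsOf-emptyColumn isRook ≡.refl cx cy n) (itemsOf-emptyColumn isFile ≡.refl cx cy n)
                          ≡.refl (emptyBoxesBy-column Rs Fs (cancelled-column Rs-right Fs-right) cy n (replicate n none)) ≡.refl))
      (split (validMixed k l p′) ≡.refl)
      where
      split : ∀ v → validMixed k l p′ ≡ v →
        (if v then q ^ (freeRows rows cy n ℕ.+ emptyBoxes p′) else 0#) ≈ q ^ (n ∸ k) * (if v then q ^ emptyBoxes p′ else 0#)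
      split true  v≡ = trans (reflexive (≡.cong (λ m → q ^ (m ℕ.+ emptyBoxes p′)) (freeRows-valid k l (≡.subst T (≡.sym v≡) _))))
                             (^-+ q (n ∸ k) (emptyBoxes p′))
      split false _  = sym (zeroʳ _)

    rooks-onlyAt : ∀ c {i} → i < n → rooksOf (zip C (onlyAt i c n)) ≡ (if isRook c then (cx , cy ℕ.+ i) ∷ [] else [])
    rooks-onlyAt c i<n = itemsOf-onlyAt isRook ≡.refl cx cy c i<n

    files-onlyAt : ∀ c {i} → i < n → filesOf (zip C (onlyAt i c n)) ≡ (if isFile c then (cx , cy ℕ.+ i) ∷ [] else [])
    files-onlyAt c i<n = itemsOf-onlyAt isFile ≡.refl cx cy c i<n

    weight-rookAt : ∀ k l {i} → i < n → weight (suc k) l (zip C (onlyAt i rook n) ++ p′) ≈ rowWeight rows cy i * weight k l p′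
    weight-rookAt k l {i} i<n = trans
      (reflexive (weight-column (suc k) l (onlyAt i rook n) (rooks-onlyAt rook i<n) (files-onlyAt rook i<n)
                                (valid-addRook Rs-right Fs-right r₀ k l) columnBoxes (emptyBoxesBy-addRook r₀ Rs Fs p′-right)))
      (weight-split (not (r₀ ∈ᵇ rows)) (validMixed k l p′) (freeRows rows cy i) (emptyBoxes p′))
      where
      r₀ : ℕ
      r₀ = cy ℕ.+ i
      columnBoxes : emptyBoxesBy ((cx , r₀) ∷ Rs) Fs (zip C (onlyAt i rook n)) ≡ freeRows rows cy i
      columnBoxes = ≡.trans (emptyBoxesBy-column ((cx , r₀) ∷ Rs) Fs (cancelled-column-rook Rs-right Fs-right r₀) cy n (onlyAt i rook n))
                            (freeCells-onlyAt rows cy ≡.refl ≡.refl i<n)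

    weight-fileAt : ∀ k l {i} → i < n → weight k (suc l) (zip C (onlyAt i file n) ++ p′) ≈ rowWeight rows cy i * weight k l p′
    weight-fileAt k l {i} i<n = trans
      (reflexive (weight-column k (suc l) (onlyAt i file n) (rooks-onlyAt file i<n) (files-onlyAt file i<n)
                                (valid-addFile Rs-right Fs-right r₀ k l) columnBoxes (emptyBoxesBy-addFile r₀ Rs Fs p′-right)))
      (weight-split (not (r₀ ∈ᵇ rows)) (validMixed k l p′) (freeRows rows cy i) (emptyBoxes p′))
      where
      r₀ : ℕ
      r₀ = cy ℕ.+ i
      columnBoxes : emptyBoxesBy Rs ((cx , r₀) ∷ Fs) (zip C (onlyAt i file n)) ≡ freeRows rows cy i
      columnBoxes = ≡.trans (emptyBoxesBy-column Rs ((cx , r₀) ∷ Fs) (cancelled-column-file Rs-right Fs-right r₀) cy n (onlyAt i file n))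
                            (freeCells-onlyAt rows cy ≡.refl ≡.refl i<n)

    weight-rookAt-noRooks : ∀ l {i} → i < n → weight zero l (zip C (onlyAt i rook n) ++ p′) ≈ 0#
    weight-rookAt-noRooks l {i} i<n =
      reflexive (weight-column zero l (onlyAt i rook n) (rooks-onlyAt rook i<n) (files-onlyAt rook i<n) ≡.refl ≡.refl ≡.refl)

    weight-fileAt-noFiles : ∀ k {i} → i < n → weight k zero (zip C (onlyAt i file n) ++ p′) ≈ 0#
    weight-fileAt-noFiles k {i} i<n =
      reflexive (weight-column k zero (onlyAt i file n) (rooks-onlyAt file i<n) (files-onlyAt file i<n)
                               (valid-noFiles k Rs (cx , cy ℕ.+ i) Fs) ≡.refl ≡.refl)

    weight-crowded : ∀ k l a → length a ≡ n → 2 ≤ occupied a → weight k l (zip C a ++ p′) ≈ 0#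
    weight-crowded k l a len crowded = weight-invalid k l (zip C a ++ p′) λ v →
      ℕ.<-irrefl ≡.refl (ℕ.≤-trans crowded (≡.subst (_≤ 1) (rooks+files≡occupied cx cy n a len)
        (valid⇒atMostOneInColumn k l _ _ Rs Fs (itemsOf-column isRook cx cy n a) (itemsOf-column isFile cx cy n a)
          (≡.subst T (≡.cong₂ (validRF k l) (itemsOf-++ isRook (zip C a) p′) (itemsOf-++ isFile (zip C a) p′)) v))))

    [freeRows]≈[n∸k] : ∀ k l → [ freeRows rows cy n ]q * weight k l p′ ≈ [ n ∸ k ]q * weight k l p′
    [freeRows]≈[n∸k] k l with validMixed k l p′ in v
    ... | true  = *-cong (reflexive (≡.cong [_]q (freeRows-valid k l (≡.subst T (≡.sym v) _)))) refl
    ... | false = trans (zeroʳ _) (sym (zeroʳ _))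

    ∑-rowWeight* : ∀ k l → ∑< n (λ i → rowWeight rows cy i * weight k l p′) ≈ [ n ∸ k ]q * weight k l p′
    ∑-rowWeight* k l = begin
      ∑< n (λ i → rowWeight rows cy i * weight k l p′) ≈⟨ *-distribʳ-∑ (weight k l p′) (upTo n) (rowWeight rows cy) ⟨
      ∑< n (rowWeight rows cy) * weight k l p′          ≈⟨ *-cong (∑-rowWeight rows cy n) refl ⟩
      [ freeRows rows cy n ]q * weight k l p′ ≈⟨ [freeRows]≈[n∸k] k l ⟩
      [ n ∸ k ]q * weight k l p′              ∎

    -- A valid placement has at most one rook or file in the column, and one in row r is legal iff no rook
    -- of p′ lies in row r. The column's cells are cancelled exactly in the rows of rooks of p′ and above
    -- the piece, so an empty column contributes q^(n - k) and a piece contributes q^(free rows below it),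
    -- which summed over the n - k free rows is [ n ∸ k ]q.
    column-sum : ∀ k l → ∑ (assignments n) (λ a → weight k l (zip C a ++ p′)) ≈ addColumn n (λ k l → weight k l p′) k l
    column-sum k l = trans (∑-assignments-atMostOne n (λ a → weight k l (zip C a ++ p′)) (weight-crowded k l))
                           (+-cong (weight-emptyColumn k l) (+-cong (rooks k) (files l)))
      where
      rooks : ∀ k → ∑< n (λ i → weight k l (zip C (onlyAt i rook n) ++ p′)) ≈ shift (λ k′ → [ n ∸ k′ ]q * weight k′ l p′) k
      rooks zero    = trans (∑<-cong n (weight-rookAt-noRooks l)) (∑-zero (upTo n))
      rooks (suc k) = trans (∑<-cong n (weight-rookAt k l)) (∑-rowWeight* k l)
      files : ∀ l → ∑< n (λ i → weight k l (zip C (onlyAt i file n) ++ p′)) ≈ shift (λ l′ → [ n ∸ k ]q * weight k l′ p′) l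
      files zero    = trans (∑<-cong n (weight-fileAt-noFiles k)) (∑-zero (upTo n))
      files (suc l) = trans (∑<-cong n (weight-fileAt k l)) (∑-rowWeight* k l)

  rookSum-column : ∀ k l cx cy n B → All (InBlock cx cy n) B →
    rookSum k l (column cx cy n ++ B) ≈ addColumn n (λ k l → rookSum k l B) k l
  rookSum-column k l cx cy n B inBlock = begin
    rookSum k l (C ++ B)
      ≈⟨ rookSum≈∑weight k l (C ++ B) ⟩
    ∑ (assignments (length (C ++ B))) (λ v → weight k l (zip (C ++ B) v))
      ≈⟨ ∑-assignments-zip-++ C B (weight k l) ⟩
    ∑ (assignments (length C)) (λ a → ∑ (assignments (length B)) (λ b → weight k l (zip C a ++ zip B b)))
      ≈⟨ ∑-comm (assignments (length C)) (assignments (length B)) _ ⟩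
    ∑ (assignments (length B)) (λ b → ∑ (assignments (length C)) (λ a → weight k l (zip C a ++ zip B b)))
      ≡⟨ ≡.cong (λ m → ∑ (assignments (length B)) (λ b → ∑ (assignments m) (λ a → weight k l (zip C a ++ zip B b))))
                (length-column cx cy n) ⟩
    ∑ (assignments (length B)) (λ b → ∑ (assignments n) (λ a → weight k l (zip C a ++ zip B b)))
      ≈⟨ ∑-cong (assignments (length B)) (λ b → Column.column-sum cx cy n (zip B b)
            (All-zip B b (All.map proj₁ inBlock)) (All-zip B b (All.map proj₂ inBlock)) k l) ⟩
    ∑ (assignments (length B)) (λ b → addColumn n (λ k l → weight k l (zip B b)) k l)
      ≈⟨ ∑-addColumn (assignments (length B)) n (λ b k l → weight k l (zip B b)) k l ⟩
    addColumn n (λ k l → ∑ (assignments (length B)) (λ b → weight k l (zip B b))) k l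
      ≈⟨ addColumn-cong n (λ k l → rookSum≈∑weight k l B) k l ⟨
    addColumn n (λ k l → rookSum k l B) k l ∎
    where
    C : List Cell
    C = column cx cy n

  rookSum-X : ∀ k l cx cy w →
    rookSum k l (board' cx cy (X ∷ w)) ≈ addColumn (#Y w) (λ k l → rookSum k l (board' (suc cx) cy w)) k l
  rookSum-X k l cx cy w = trans (reflexive (≡.cong (rookSum k l) (board′-X cx cy w)))
                                (rookSum-column k l cx cy (#Y w) (board' (suc cx) cy w) (board′-inBlock cx cy w))

  rookSum-fewRows : ∀ k l cx cy w → #Y w < k → rookSum k l (board' cx cy w) ≈ 0#
  rookSum-fewRows (suc k) l cx cy []      _ = refl
  rookSum-fewRows k       l cx cy (Y ∷ w) n<k = rookSum-fewRows k l cx (suc cy) w (ℕ.<-trans (ℕ.n<1+n _) n<k)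
  rookSum-fewRows k       l cx cy (X ∷ w) n<k = begin
    rookSum k l (board' cx cy (X ∷ w))   ≈⟨ rookSum-X k l cx cy w ⟩
    addColumn (#Y w) (λ k l → rookSum k l B′) k l
      ≈⟨ +-cong (trans (*-cong refl (rookSum-fewRows k l (suc cx) cy w n<k)) (zeroʳ _)) (+-cong (rooks k n<k) (files l)) ⟩
    0# + (0# + 0#)                        ≈⟨ trans (+-identityˡ _) (+-identityˡ _) ⟩
    0#                                    ∎
    where
    B′ : List Cell
    B′ = board' (suc cx) cy w
    rooks : ∀ k → #Y w < k → shift (λ k′ → [ #Y w ∸ k′ ]q * rookSum k′ l B′) k ≈ 0#
    rooks (suc k) n<k with ℕ.m≤n⇒m<n∨m≡n (ℕ.≤-pred n<k)
    ... | inj₁ n<k′   = trans (*-cong refl (rookSum-fewRows k l (suc cx) cy w n<k′)) (zeroʳ _)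
    ... | inj₂ ≡.refl = trans (*-cong (reflexive (≡.cong [_]q (ℕ.n∸n≡0 k))) refl) (zeroˡ _)
    files : ∀ l → shift (λ l′ → [ #Y w ∸ k ]q * rookSum k l′ B′) l ≈ 0#
    files zero    = refl
    files (suc l) = trans (*-cong refl (rookSum-fewRows k l (suc cx) cy w n<k)) (zeroʳ _)

  rookSum-fewColumns : ∀ k l cx cy w → #X w < k ℕ.+ l → rookSum k l (board' cx cy w) ≈ 0#
  rookSum-fewColumns (suc k) l       cx cy []      _ = refl
  rookSum-fewColumns zero    (suc l) cx cy []      _ = refl
  rookSum-fewColumns k       l       cx cy (Y ∷ w) L<k+l = rookSum-fewColumns k l cx (suc cy) w L<k+l
  rookSum-fewColumns k       l       cx cy (X ∷ w) L<k+l = begin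
    rookSum k l (board' cx cy (X ∷ w))   ≈⟨ rookSum-X k l cx cy w ⟩
    addColumn (#Y w) (λ k l → rookSum k l B′) k l
      ≈⟨ +-cong (trans (*-cong refl (rookSum-fewColumns k l (suc cx) cy w (ℕ.<-trans (ℕ.n<1+n _) L<k+l))) (zeroʳ _))
                (+-cong (rooks k L<k+l) (files l L<k+l)) ⟩
    0# + (0# + 0#)                        ≈⟨ trans (+-identityˡ _) (+-identityˡ _) ⟩
    0#                                    ∎
    where
    B′ : List Cell
    B′ = board' (suc cx) cy w
    rooks : ∀ k → suc (#X w) < k ℕ.+ l → shift (λ k′ → [ #Y w ∸ k′ ]q * rookSum k′ l B′) k ≈ 0#
    rooks zero    _     = refl
    rooks (suc k) L<k+l = trans (*-cong refl (rookSum-fewColumns k l (suc cx) cy w (ℕ.≤-pred L<k+l))) (zeroʳ _)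
    files : ∀ l → suc (#X w) < k ℕ.+ l → shift (λ l′ → [ #Y w ∸ k ]q * rookSum k l′ B′) l ≈ 0#
    files zero    _     = refl
    files (suc l) L<k+l =
      trans (*-cong refl (rookSum-fewColumns k l (suc cx) cy w (ℕ.≤-pred (≡.subst (suc (#X w) <_) (ℕ.+-suc k l) L<k+l)))) (zeroʳ _)

module Centrality {c ℓ} (R : Ring c ℓ) where
  open Ring R hiding (zero)
  open Sums R
  open import Relation.Binary.Reasoning.Setoid setoid

  central-0# : Central R 0#
  central-0# z = trans (zeroˡ z) (sym (zeroʳ z))

  central-1# : Central R 1#
  central-1# z = trans (*-identityˡ z) (sym (*-identityʳ z))

  central-+ : ∀ {a b} → Central R a → Central R b → Central R (a + b)
  central-+ ca cb z = trans (distribʳ _ _ _) (trans (+-cong (ca z) (cb z)) (sym (distribˡ _ _ _)))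

  central-* : ∀ {a b} → Central R a → Central R b → Central R (a * b)
  central-* {a} {b} ca cb z = begin
    a * b * z   ≈⟨ *-assoc _ _ _ ⟩
    a * (b * z) ≈⟨ *-cong refl (cb z) ⟩
    a * (z * b) ≈⟨ *-assoc _ _ _ ⟨
    a * z * b   ≈⟨ *-cong (ca z) refl ⟩
    z * a * b   ≈⟨ *-assoc _ _ _ ⟩
    z * (a * b) ∎

  central-pow : ∀ {a} → Central R a → ∀ n → Central R (pow R a n)
  central-pow ca zero    = central-1#
  central-pow ca (suc n) = central-* ca (central-pow ca n)

  central-∑ : {A : Set} (xs : List A) {f : A → Carrier} → (∀ a → Central R (f a)) → Central R (∑ xs f)
  central-∑ []       cf = central-0#
  central-∑ (a ∷ xs) cf = central-+ (cf a) (central-∑ xs cf)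

  central-swap : ∀ {c} → Central R c → ∀ a b → a * (c * b) ≈ c * (a * b)
  central-swap cc a b = trans (sym (*-assoc _ _ _)) (trans (*-cong (sym (cc a)) refl) (*-assoc _ _ _))

  central-exchange : ∀ {c} → Central R c → ∀ a b s → a * b * (c * s) ≈ a * c * (b * s)
  central-exchange {c} cc a b s = begin
    a * b * (c * s)   ≈⟨ central-swap cc _ _ ⟩
    c * (a * b * s)   ≈⟨ *-cong refl (*-assoc _ _ _) ⟩
    c * (a * (b * s)) ≈⟨ *-assoc _ _ _ ⟨
    c * a * (b * s)   ≈⟨ *-cong (cc a) refl ⟩
    a * c * (b * s)   ∎

  central-swap₂ : ∀ {a b} → Central R a → Central R b → ∀ m s → m * (a * (b * s)) ≈ b * a * m * s
  central-swap₂ {a} {b} ca cb m s = begin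
    m * (a * (b * s)) ≈⟨ central-swap ca m _ ⟩
    a * (m * (b * s)) ≈⟨ *-cong refl (central-swap cb m s) ⟩
    a * (b * (m * s)) ≈⟨ *-assoc _ _ _ ⟨
    a * b * (m * s)   ≈⟨ *-cong (ca b) refl ⟩
    b * a * (m * s)   ≈⟨ *-assoc _ _ _ ⟨
    b * a * m * s     ∎

module _ {c ℓ} (R : Ring c ℓ) where
  open Ring R hiding (zero)
  open Sums R
  open Centrality R

  module Ore (μ ν q x y : Carrier) (μ-central : Central R μ) (ν-central : Central R ν) (q-central : Central R q)
             (relation : x * y + - (q * y * x) ≈ μ + ν * y) where
    open RookSums R q
    open import Relation.Binary.Reasoning.Setoid setoid
    open import Algebra.Solver.CommutativeMonoid +-commutativeMonoid using (solve; _⊕_; _⊜_)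

    0*_*_ : ∀ a b → 0# * a * b ≈ 0#
    0* a * b = trans (*-cong (zeroˡ a) refl) (zeroˡ b)

    *-distribʳ-+₃ : ∀ a b c d → (a + (b + c)) * d ≈ a * d + (b * d + c * d)
    *-distribʳ-+₃ a b c d = trans (distribʳ _ _ _) (+-cong refl (distribʳ _ _ _))

    xy≈ : x * y ≈ q * y * x + (μ + ν * y)
    xy≈ = begin
      x * y                                ≈⟨ +-identityʳ _ ⟨
      x * y + 0#                           ≈⟨ +-cong refl (-‿inverseˡ _) ⟨
      x * y + (- (q * y * x) + q * y * x)  ≈⟨ +-assoc _ _ _ ⟨
      x * y + - (q * y * x) + q * y * x    ≈⟨ +-cong relation refl ⟩
      μ + ν * y + q * y * x                ≈⟨ +-comm _ _ ⟩
      q * y * x + (μ + ν * y)              ∎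

    [_]q-central : ∀ n → Central R [ n ]q
    [ zero  ]q-central = central-0#
    [ suc n ]q-central = central-+ central-1# (central-* q-central [ n ]q-central)

    y*[j]q : ∀ j → y * ([ j ]q * (μ * y ^ pred j + ν * y ^ j)) ≈ [ j ]q * (μ * y ^ j + ν * y ^ suc j)
    y*[j]q zero    = trans (*-cong refl (zeroˡ _)) (trans (zeroʳ y) (sym (zeroˡ _)))
    y*[j]q (suc j) = trans (central-swap [ suc j ]q-central y _) (*-cong refl (trans (distribˡ _ _ _)
                       (+-cong (central-swap μ-central y _) (central-swap ν-central y _))))

    -- At j = 0 the junk exponent pred 0 is harmless: it is multiplied by [ 0 ]q = 0#.
    x*y^ : ∀ j → x * y ^ j ≈ q ^ j * y ^ j * x + [ j ]q * (μ * y ^ pred j + ν * y ^ j)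
    x*y^ zero = begin
      x * 1#                                  ≈⟨ *-identityʳ x ⟩
      x                                       ≈⟨ trans (*-cong (*-identityˡ 1#) refl) (*-identityˡ x) ⟨
      1# * 1# * x                             ≈⟨ +-identityʳ _ ⟨
      1# * 1# * x + 0#                        ≈⟨ +-cong refl (zeroˡ _) ⟨
      1# * 1# * x + 0# * (μ * 1# + ν * 1#)    ∎
    x*y^ (suc j) = begin
      x * (y * y ^ j)
        ≈⟨ *-assoc _ _ _ ⟨
      x * y * y ^ j
        ≈⟨ *-cong xy≈ refl ⟩
      (q * y * x + (μ + ν * y)) * y ^ j
        ≈⟨ distribʳ _ _ _ ⟩
      q * y * x * y ^ j + (μ + ν * y) * y ^ j
        ≈⟨ +-cong (*-assoc _ _ _) (trans (distribʳ _ _ _) (+-cong refl (*-assoc _ _ _))) ⟩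
      q * y * (x * y ^ j) + S
        ≈⟨ +-cong (*-cong refl (x*y^ j)) refl ⟩
      q * y * (q ^ j * y ^ j * x + [ j ]q * (μ * y ^ pred j + ν * y ^ j)) + S
        ≈⟨ +-cong (distribˡ _ _ _) refl ⟩
      q * y * (q ^ j * y ^ j * x) + q * y * ([ j ]q * (μ * y ^ pred j + ν * y ^ j)) + S
        ≈⟨ +-cong (+-cong leading (trans (*-assoc _ _ _) (*-cong refl (y*[j]q j)))) refl ⟩
      q ^ suc j * y ^ suc j * x + q * ([ j ]q * S) + S
        ≈⟨ trans (+-assoc _ _ _) (+-cong refl (+-comm _ _)) ⟩
      q ^ suc j * y ^ suc j * x + (S + q * ([ j ]q * S))
        ≈⟨ +-cong refl (+-cong (*-identityˡ S) (*-assoc _ _ _)) ⟨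
      q ^ suc j * y ^ suc j * x + (1# * S + q * [ j ]q * S)
        ≈⟨ +-cong refl (distribʳ S 1# (q * [ j ]q)) ⟨
      q ^ suc j * y ^ suc j * x + [ suc j ]q * S ∎
      where
      S : Carrier
      S = μ * y ^ j + ν * y ^ suc j
      leading : q * y * (q ^ j * y ^ j * x) ≈ q ^ suc j * y ^ suc j * x
      leading = begin
        q * y * (q ^ j * y ^ j * x)    ≈⟨ *-cong refl (*-assoc _ _ _) ⟩
        q * y * (q ^ j * (y ^ j * x))  ≈⟨ *-assoc _ _ _ ⟩
        q * (y * (q ^ j * (y ^ j * x))) ≈⟨ *-cong refl (central-swap (central-pow q-central j) y _) ⟩
        q * (q ^ j * (y * (y ^ j * x))) ≈⟨ *-assoc _ _ _ ⟨
        q ^ suc j * (y * (y ^ j * x))  ≈⟨ *-cong refl (*-assoc _ _ _) ⟨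
        q ^ suc j * (y ^ suc j * x)    ≈⟨ *-assoc _ _ _ ⟨
        q ^ suc j * y ^ suc j * x      ∎

    M : ℕ → ℕ → List Cell → Carrier
    M t f B = mixedRookPoly R μ ν q t f B

    M-central : ∀ t f B → Central R (M t f B)
    M-central t f B = central-* (central-* (central-pow μ-central t) (central-pow ν-central f))
                                (central-∑ (mixedPlacements t f B) (λ φ → central-pow q-central (emptyBoxes φ)))

    M≈0 : ∀ t f B → rookSum t f B ≈ 0# → M t f B ≈ 0#
    M≈0 t f B S≈0 = trans (*-cong refl S≈0) (zeroʳ _)

    M-fewRows : ∀ t f cx cy w → #Y w < t → M t f (board' cx cy w) ≈ 0#
    M-fewRows t f cx cy w n<t = M≈0 t f (board' cx cy w) (rookSum-fewRows t f cx cy w n<t)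

    M-fewColumns : ∀ t f cx cy w → #X w < t ℕ.+ f → M t f (board' cx cy w) ≈ 0#
    M-fewColumns t f cx cy w L<t+f = M≈0 t f (board' cx cy w) (rookSum-fewColumns t f cx cy w L<t+f)

    M-X : ∀ t f cx cy w → let n = #Y w ; B′ = board' (suc cx) cy w in
      M t f (board' cx cy (X ∷ w)) ≈
      q ^ (n ∸ t) * M t f B′ + (shift (λ t′ → μ * [ n ∸ t′ ]q * M t′ f B′) t + shift (λ f′ → ν * [ n ∸ t ]q * M t f′ B′) f)
    M-X t f cx cy w = begin
      μ ^ t * ν ^ f * rookSum t f (board' cx cy (X ∷ w))
        ≈⟨ *-cong refl (rookSum-X t f cx cy w) ⟩
      μ ^ t * ν ^ f * addColumn n (λ t f → rookSum t f B′) t f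
        ≈⟨ trans (distribˡ _ _ _) (+-cong (central-swap (central-pow q-central (n ∸ t)) _ _)
                                          (trans (distribˡ _ _ _) (+-cong (rooks t) (files f)))) ⟩
      q ^ (n ∸ t) * M t f B′ + (shift (λ t′ → μ * [ n ∸ t′ ]q * M t′ f B′) t + shift (λ f′ → ν * [ n ∸ t ]q * M t f′ B′) f) ∎
      where
      n : ℕ
      n = #Y w
      B′ : List Cell
      B′ = board' (suc cx) cy w
      rooks : ∀ t → μ ^ t * ν ^ f * shift (λ t′ → [ n ∸ t′ ]q * rookSum t′ f B′) t ≈
                    shift (λ t′ → μ * [ n ∸ t′ ]q * M t′ f B′) t
      rooks zero    = zeroʳ _
      rooks (suc t) = trans (*-cong (*-assoc _ _ _) refl) (central-exchange [ n ∸ t ]q-central μ _ _)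
      files : ∀ f → μ ^ t * ν ^ f * shift (λ f′ → [ n ∸ t ]q * rookSum t f′ B′) f ≈
                    shift (λ f′ → ν * [ n ∸ t ]q * M t f′ B′) f
      files zero    = zeroʳ _
      files (suc f) = trans (*-cong (central-swap ν-central _ _) refl) (central-exchange [ n ∸ t ]q-central ν _ _)

    normalTerm : List Cell → ℕ → ℕ → ℕ → ℕ → Carrier
    normalTerm B n k t f = M t f B * y ^ (n ∸ t) * x ^ k

    y^*normalTerm : ∀ e cx cy w k t f →
      y ^ e * normalTerm (board' cx cy w) (#Y w) k t f ≈ normalTerm (board' cx cy w) (e ℕ.+ #Y w) k t f
    y^*normalTerm e cx cy w k t f with t ℕ.≤? #Y w
    ... | yes t≤n = begin
      y ^ e * (M′ * y ^ (#Y w ∸ t) * x ^ k)   ≈⟨ *-assoc _ _ _ ⟨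
      y ^ e * (M′ * y ^ (#Y w ∸ t)) * x ^ k   ≈⟨ *-cong (central-swap (M-central t f (board' cx cy w)) _ _) refl ⟩
      M′ * (y ^ e * y ^ (#Y w ∸ t)) * x ^ k   ≈⟨ *-cong (*-cong refl (^-+ y e (#Y w ∸ t))) refl ⟨
      M′ * y ^ (e ℕ.+ (#Y w ∸ t)) * x ^ k     ≡⟨ ≡.cong (λ j → M′ * y ^ j * x ^ k) (ℕ.+-∸-assoc e t≤n) ⟨
      M′ * y ^ (e ℕ.+ #Y w ∸ t) * x ^ k       ∎
      where
      M′ : Carrier
      M′ = M t f (board' cx cy w)
    ... | no t≰n = trans (*-cong refl (vanishes (#Y w ∸ t))) (trans (zeroʳ _) (sym (vanishes (e ℕ.+ #Y w ∸ t))))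
      where
      vanishes : ∀ j → M t f (board' cx cy w) * y ^ j * x ^ k ≈ 0#
      vanishes j = trans (*-cong (*-cong (M-fewRows t f cx cy w (ℕ.≰⇒> t≰n)) refl) refl) (0* _ * _)

    module XStep (cx cy : ℕ) (w : Word) where

      n L : ℕ
      n = #Y w
      L = #X w

      B′ : List Cell
      B′ = board' (suc cx) cy w

      -- The three terms of x * normalTerm coming from x y^j; up to a shift of k, t or f respectively
      -- they are the three terms of the column recursion for board' cx cy (X ∷ w).
      lead rookTerm fileTerm : ℕ → ℕ → ℕ → Carrier
      lead     k t f = q ^ (n ∸ t) * M t f B′ * y ^ (n ∸ t) * x ^ k
      rookTerm k t f = μ * [ n ∸ t ]q * M t f B′ * y ^ (n ∸ suc t) * x ^ k
      fileTerm k t f = ν * [ n ∸ t ]q * M t f B′ * y ^ (n ∸ t) * x ^ k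

      x*normalTerm : ∀ k t f → x * normalTerm B′ n k t f ≈ lead (suc k) t f + (rookTerm k t f + fileTerm k t f)
      x*normalTerm k t f = begin
        x * (M′ * y ^ j * x ^ k)                                              ≈⟨ *-assoc _ _ _ ⟨
        x * (M′ * y ^ j) * x ^ k                                              ≈⟨ *-cong (central-swap (M-central t f B′) x _) refl ⟩
        M′ * (x * y ^ j) * x ^ k                                              ≈⟨ *-cong (*-cong refl (x*y^ j)) refl ⟩
        M′ * (q ^ j * y ^ j * x + [ j ]q * (μ * y ^ pred j + ν * y ^ j)) * x ^ k
          ≈⟨ *-cong (trans (distribˡ _ _ _) (+-cong refl (trans (*-cong refl (distribˡ _ _ _)) (distribˡ _ _ _)))) refl ⟩
        (M′ * (q ^ j * y ^ j * x) + (M′ * ([ j ]q * (μ * y ^ pred j)) + M′ * ([ j ]q * (ν * y ^ j)))) * x ^ k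
          ≈⟨ *-distribʳ-+₃ _ _ _ _ ⟩
        M′ * (q ^ j * y ^ j * x) * x ^ k + (M′ * ([ j ]q * (μ * y ^ pred j)) * x ^ k + M′ * ([ j ]q * (ν * y ^ j)) * x ^ k)
          ≈⟨ +-cong leading (+-cong (*-cong (central-swap₂ [ j ]q-central μ-central M′ _) refl)
                                    (*-cong (central-swap₂ [ j ]q-central ν-central M′ _) refl)) ⟩
        lead (suc k) t f + (μ * [ j ]q * M′ * y ^ pred j * x ^ k + fileTerm k t f)
          ≡⟨ ≡.cong (λ e → lead (suc k) t f + (μ * [ j ]q * M′ * y ^ e * x ^ k + fileTerm k t f)) (ℕ.pred[m∸n]≡m∸[1+n] n t) ⟩
        lead (suc k) t f + (rookTerm k t f + fileTerm k t f)                 ∎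
        where
        j : ℕ
        j = n ∸ t
        M′ : Carrier
        M′ = M t f B′
        leading : M′ * (q ^ j * y ^ j * x) * x ^ k ≈ lead (suc k) t f
        leading = begin
          M′ * (q ^ j * y ^ j * x) * x ^ k   ≈⟨ *-cong (*-assoc _ _ _) refl ⟨
          M′ * (q ^ j * y ^ j) * x * x ^ k   ≈⟨ *-assoc _ _ _ ⟩
          M′ * (q ^ j * y ^ j) * x ^ suc k   ≈⟨ *-cong (trans (sym (*-assoc _ _ _)) (*-cong (sym (central-pow q-central j M′)) refl)) refl ⟩
          q ^ j * M′ * y ^ j * x ^ suc k     ∎

      normalTerm-X : ∀ k t f → normalTerm (board' cx cy (X ∷ w)) n k t f ≈
        lead k t f + (shift (λ t′ → rookTerm k t′ f) t + shift (fileTerm k t) f)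
      normalTerm-X k t f = begin
        M t f (board' cx cy (X ∷ w)) * y ^ (n ∸ t) * x ^ k
          ≈⟨ *-cong (*-cong (M-X t f cx cy w) refl) refl ⟩
        (q ^ (n ∸ t) * M t f B′ + (shift μTerm t + shift νTerm f)) * y ^ (n ∸ t) * x ^ k
          ≈⟨ trans (*-cong (*-distribʳ-+₃ _ _ _ _) refl) (*-distribʳ-+₃ _ _ _ _) ⟩
        lead k t f + (shift μTerm t * y ^ (n ∸ t) * x ^ k + shift νTerm f * y ^ (n ∸ t) * x ^ k)
          ≈⟨ +-cong refl (+-cong (rooks t) (files f)) ⟩
        lead k t f + (shift (λ t′ → rookTerm k t′ f) t + shift (fileTerm k t) f) ∎
        where
        μTerm νTerm : ℕ → Carrier
        μTerm t′ = μ * [ n ∸ t′ ]q * M t′ f B′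
        νTerm f′ = ν * [ n ∸ t ]q * M t f′ B′
        rooks : ∀ t → shift μTerm t * y ^ (n ∸ t) * x ^ k ≈ shift (λ t′ → rookTerm k t′ f) t
        rooks zero    = 0* _ * _
        rooks (suc t) = refl
        files : ∀ f → shift νTerm f * y ^ (n ∸ t) * x ^ k ≈ shift (fileTerm k t) f
        files zero    = 0* _ * _
        files (suc f) = refl

      ∑₃-lead : ∑₃ (suc L) lead ≈ ∑₃ L (lead ∘ suc)
      ∑₃-lead = trans (∑₃-suc-head L lead) (trans (+-cong noColumnLeft refl) (+-identityˡ _))
        where
        -- For k = 0 the placements have t + f = L + 1 pieces in distinct columns of B′, which has only L.
        noColumnLeft : ∑₂ (suc L) (lead 0) ≈ 0#
        noColumnLeft = trans (∑<-cong (suc (suc L)) (λ t<ssL → vanishes (ℕ.≤-pred t<ssL))) (∑-zero (upTo (suc (suc L))))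
          where
          vanishes : ∀ {t} → t ≤ suc L → lead 0 t (suc L ∸ t) ≈ 0#
          vanishes {t} t≤sL =
            trans (*-cong (*-cong (trans (*-cong refl (M-fewColumns t (suc L ∸ t) (suc cx) cy w L<t+f)) (zeroʳ _)) refl) refl)
                  (0* _ * _)
            where
            L<t+f : L < t ℕ.+ (suc L ∸ t)
            L<t+f = ≡.subst (L <_) (≡.sym (ℕ.m+[n∸m]≡n t≤sL)) (ℕ.n<1+n L)

      step : x * ∑₃ L (normalTerm B′ n) ≈ ∑₃ (suc L) (normalTerm (board' cx cy (X ∷ w)) n)
      step = begin
        x * ∑₃ L (normalTerm B′ n)
          ≈⟨ *-distribˡ-∑₃ x L (normalTerm B′ n) ⟩
        ∑₃ L (λ k t f → x * normalTerm B′ n k t f)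
          ≈⟨ ∑₃-cong L x*normalTerm ⟩
        ∑₃ L (λ k t f → lead (suc k) t f + (rookTerm k t f + fileTerm k t f))
          ≈⟨ trans (∑₃-distrib-+ L (lead ∘ suc) (λ k t f → rookTerm k t f + fileTerm k t f))
                   (+-cong refl (∑₃-distrib-+ L rookTerm fileTerm)) ⟩
        ∑₃ L (lead ∘ suc) + (∑₃ L rookTerm + ∑₃ L fileTerm)
          ≈⟨ +-cong ∑₃-lead (+-cong (∑₃-shift₂ L rookTerm) (∑₃-shift₃ L fileTerm)) ⟨
        ∑₃ (suc L) lead + (∑₃ (suc L) shiftedRook + ∑₃ (suc L) shiftedFile)
          ≈⟨ trans (∑₃-distrib-+ (suc L) lead (λ k t f → shiftedRook k t f + shiftedFile k t f))
                   (+-cong refl (∑₃-distrib-+ (suc L) shiftedRook shiftedFile)) ⟨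
        ∑₃ (suc L) (λ k t f → lead k t f + (shiftedRook k t f + shiftedFile k t f))
          ≈⟨ ∑₃-cong (suc L) normalTerm-X ⟨
        ∑₃ (suc L) (normalTerm (board' cx cy (X ∷ w)) n) ∎
        where
        shiftedRook shiftedFile : ℕ → ℕ → ℕ → Carrier
        shiftedRook k t f = shift (λ t′ → rookTerm k t′ f) t
        shiftedFile k t f = shift (fileTerm k t) f

    ⟦_⟧ : Word → Carrier
    ⟦ []    ⟧ = 1#
    ⟦ X ∷ w ⟧ = x * ⟦ w ⟧
    ⟦ Y ∷ w ⟧ = y * ⟦ w ⟧

    normalForm : ∀ cx cy w → ⟦ w ⟧ ≈ ∑₃ (#X w) (normalTerm (board' cx cy w) (#Y w))
    normalForm cx cy [] = sym (begin
      ((1# * 1# * (1# + 0#)) * 1# * 1# + 0#) + 0# ≈⟨ trans (+-identityʳ _) (+-identityʳ _) ⟩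
      (1# * 1# * (1# + 0#)) * 1# * 1#            ≈⟨ trans (*-identityʳ _) (*-identityʳ _) ⟩
      1# * 1# * (1# + 0#)                        ≈⟨ trans (*-cong (*-identityˡ 1#) refl) (trans (*-identityˡ _) (+-identityʳ _)) ⟩
      1#                                         ∎)
    normalForm cx cy (X ∷ w) = trans (*-cong refl (normalForm (suc cx) cy w)) (XStep.step cx cy w)
    normalForm cx cy (Y ∷ w) = begin
      y * ⟦ w ⟧
        ≈⟨ *-cong refl (normalForm cx (suc cy) w) ⟩
      y * ∑₃ (#X w) (normalTerm B (#Y w))
        ≈⟨ *-distribˡ-∑₃ y (#X w) (normalTerm B (#Y w)) ⟩
      ∑₃ (#X w) (λ k t f → y * normalTerm B (#Y w) k t f)
        ≈⟨ ∑₃-cong (#X w) (λ k t f → trans (*-cong (sym (*-identityʳ y)) refl) (y^*normalTerm 1 cx (suc cy) w k t f)) ⟩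
      ∑₃ (#X w) (normalTerm B (suc (#Y w))) ∎
      where
      B : List Cell
      B = board' cx (suc cy) w

    y^*⟦⟧ : ∀ e w → y ^ e * ⟦ w ⟧ ≈ ∑₃ (#X w) (normalTerm (board w) (e ℕ.+ #Y w))
    y^*⟦⟧ e w = begin
      y ^ e * ⟦ w ⟧                                                   ≈⟨ *-cong refl (normalForm 0 0 w) ⟩
      y ^ e * ∑₃ (#X w) (normalTerm (board w) (#Y w))                 ≈⟨ *-distribˡ-∑₃ (y ^ e) (#X w) (normalTerm (board w) (#Y w)) ⟩
      ∑₃ (#X w) (λ k t f → y ^ e * normalTerm (board w) (#Y w) k t f) ≈⟨ ∑₃-cong (#X w) (y^*normalTerm e 0 0 w) ⟩
      ∑₃ (#X w) (normalTerm (board w) (e ℕ.+ #Y w))                   ∎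

    ⟦⟧-++ : ∀ u v → ⟦ u ++ v ⟧ ≈ ⟦ u ⟧ * ⟦ v ⟧
    ⟦⟧-++ []      v = sym (*-identityˡ _)
    ⟦⟧-++ (X ∷ u) v = trans (*-cong refl (⟦⟧-++ u v)) (sym (*-assoc _ _ _))
    ⟦⟧-++ (Y ∷ u) v = trans (*-cong refl (⟦⟧-++ u v)) (sym (*-assoc _ _ _))

    ⟦Yʲ⟧ : ∀ j → ⟦ replicate j Y ⟧ ≈ y ^ j
    ⟦Yʲ⟧ zero    = refl
    ⟦Yʲ⟧ (suc j) = *-cong refl (⟦Yʲ⟧ j)

    ⟦omega-∷⟧ : ∀ a ps → ⟦ omega (a ∷ ps) ⟧ ≈ x * (y ^ (a ∸ largestPart ps) * ⟦ omega ps ⟧)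
    ⟦omega-∷⟧ a ps = trans (reflexive (≡.cong ⟦_⟧ (omega-∷ a ps)))
      (*-cong refl (trans (⟦⟧-++ (replicate (a ∸ largestPart ps) Y) (omega ps)) (*-cong (⟦Yʲ⟧ (a ∸ largestPart ps)) refl)))

    -- The sum of all words with a letters y and l letters x.
    wordSum : ℕ → ℕ → Carrier
    wordSum a l = ∑ (partsBox a l) (λ ps → y ^ (a ∸ largestPart ps) * ⟦ omega ps ⟧)

    wordSum-zero : ∀ a → wordSum a 0 ≈ y ^ a
    wordSum-zero a = trans (+-identityʳ _) (*-identityʳ _)

    wordSum-suc : ∀ a l → wordSum a (suc l) ≈ ∑< (suc a) (λ j → y ^ (a ∸ j) * (x * wordSum j l))
    wordSum-suc a l = begin
      wordSum a (suc l)
        ≈⟨ ∑-concatMap (λ j → map (j ∷_) (partsBox j l)) (upTo (suc a)) _ ⟩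
      ∑< (suc a) (λ j → ∑ (map (j ∷_) (partsBox j l)) (λ ps → y ^ (a ∸ largestPart ps) * ⟦ omega ps ⟧))
        ≈⟨ ∑-cong (upTo (suc a)) (λ j → begin
             ∑ (map (j ∷_) (partsBox j l)) (λ ps → y ^ (a ∸ largestPart ps) * ⟦ omega ps ⟧)
               ≈⟨ ∑-map (j ∷_) (partsBox j l) _ ⟩
             ∑ (partsBox j l) (λ ps → y ^ (a ∸ j) * ⟦ omega (j ∷ ps) ⟧)
               ≈⟨ ∑-cong (partsBox j l) (λ ps → *-cong refl (⟦omega-∷⟧ j ps)) ⟩
             ∑ (partsBox j l) (λ ps → y ^ (a ∸ j) * (x * (y ^ (j ∸ largestPart ps) * ⟦ omega ps ⟧)))
               ≈⟨ trans (*-cong refl (*-distribˡ-∑ x (partsBox j l) _)) (*-distribˡ-∑ (y ^ (a ∸ j)) (partsBox j l) _) ⟨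
             y ^ (a ∸ j) * (x * wordSum j l) ∎) ⟩
      ∑< (suc a) (λ j → y ^ (a ∸ j) * (x * wordSum j l)) ∎

    wordSum-0-suc : ∀ l → wordSum 0 (suc l) ≈ x * wordSum 0 l
    wordSum-0-suc l = trans (wordSum-suc 0 l) (trans (+-identityʳ _) (*-identityˡ _))

    wordSum-suc-suc : ∀ a l → wordSum (suc a) (suc l) ≈ y * wordSum a (suc l) + x * wordSum (suc a) l
    wordSum-suc-suc a l = begin
      wordSum (suc a) (suc l)
        ≈⟨ wordSum-suc (suc a) l ⟩
      ∑< (suc (suc a)) (λ j → y ^ (suc a ∸ j) * (x * wordSum j l))
        ≈⟨ ∑<-suc-last (suc a) _ ⟩
      ∑< (suc a) (λ j → y ^ (suc a ∸ j) * (x * wordSum j l)) + y ^ (a ∸ a) * (x * wordSum (suc a) l)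
        ≈⟨ +-cong (∑<-cong (suc a) (λ {j} j<sa →
                     trans (reflexive (≡.cong (λ e → y ^ e * (x * wordSum j l)) (ℕ.+-∸-assoc 1 (ℕ.≤-pred j<sa))))
                           (*-assoc _ _ _)))
                  (trans (reflexive (≡.cong (λ e → y ^ e * (x * wordSum (suc a) l)) (ℕ.n∸n≡0 a))) (*-identityˡ _)) ⟩
      ∑< (suc a) (λ j → y * (y ^ (a ∸ j) * (x * wordSum j l))) + x * wordSum (suc a) l
        ≈⟨ +-cong (*-distribˡ-∑ y (upTo (suc a)) _) refl ⟨
      y * ∑< (suc a) (λ j → y ^ (a ∸ j) * (x * wordSum j l)) + x * wordSum (suc a) l
        ≈⟨ +-cong (*-cong refl (wordSum-suc a l)) refl ⟨
      y * wordSum a (suc l) + x * wordSum (suc a) l ∎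

    binomial : ∀ m → (x + y) ^ m ≈ ∑< (suc m) (λ l → wordSum (m ∸ l) l)
    binomial zero    = sym (trans (+-identityʳ _) (wordSum-zero 0))
    binomial (suc m) = begin
      (x + y) * (x + y) ^ m
        ≈⟨ *-cong refl (binomial m) ⟩
      (x + y) * ∑< (suc m) W
        ≈⟨ distribʳ _ _ _ ⟩
      x * ∑< (suc m) W + y * ∑< (suc m) W
        ≈⟨ +-cong (*-distribˡ-∑ x (upTo (suc m)) W) (trans (*-distribˡ-∑ y (upTo (suc m)) W) (∑<-suc m _)) ⟩
      xW + (y * wordSum m 0 + yW)
        ≈⟨ solve 3 (λ a b c → a ⊕ (b ⊕ c) ⊜ b ⊕ (c ⊕ a)) refl xW _ yW ⟩
      y * wordSum m 0 + (yW + xW)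
        ≈⟨ +-cong (trans (*-cong refl (wordSum-zero m)) (sym (wordSum-zero (suc m)))) (sym shifted) ⟩
      wordSum (suc m) 0 + ∑< (suc m) (λ l → wordSum (m ∸ l) (suc l))
        ≈⟨ ∑<-suc (suc m) _ ⟨
      ∑< (suc (suc m)) (λ l → wordSum (suc m ∸ l) l) ∎
      where
      W : ℕ → Carrier
      W l = wordSum (m ∸ l) l
      xW yW : Carrier
      xW = ∑< (suc m) (λ l → x * W l)
      yW = ∑< m (λ l → y * wordSum (m ∸ suc l) (suc l))
      shifted : ∑< (suc m) (λ l → wordSum (m ∸ l) (suc l)) ≈ yW + xW
      shifted = begin
        ∑< (suc m) (λ l → wordSum (m ∸ l) (suc l))
          ≈⟨ ∑<-suc-last m _ ⟩
        ∑< m (λ l → wordSum (m ∸ l) (suc l)) + wordSum (m ∸ m) (suc m)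
          ≈⟨ +-cong (∑<-cong m inner) last ⟩
        ∑< m (λ l → y * wordSum (m ∸ suc l) (suc l) + x * W l) + x * W m
          ≈⟨ +-cong (∑-distrib-+ (upTo m) _ _) refl ⟩
        yW + ∑< m (λ l → x * W l) + x * W m
          ≈⟨ trans (+-assoc _ _ _) (+-cong refl (sym (∑<-suc-last m (λ l → x * W l)))) ⟩
        yW + xW ∎
        where
        inner : ∀ {l} → l < m → wordSum (m ∸ l) (suc l) ≈ y * wordSum (m ∸ suc l) (suc l) + x * W l
        inner {l} l<m = begin
          wordSum (m ∸ l) (suc l)
            ≡⟨ ≡.cong (λ a → wordSum a (suc l)) m∸l≡ ⟩
          wordSum (suc (m ∸ suc l)) (suc l)
            ≈⟨ wordSum-suc-suc (m ∸ suc l) l ⟩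
          y * wordSum (m ∸ suc l) (suc l) + x * wordSum (suc (m ∸ suc l)) l
            ≡⟨ ≡.cong (λ a → y * wordSum (m ∸ suc l) (suc l) + x * wordSum a l) m∸l≡ ⟨
          y * wordSum (m ∸ suc l) (suc l) + x * W l ∎
          where
          m∸l≡ : m ∸ l ≡ suc (m ∸ suc l)
          m∸l≡ = ℕ.+-∸-assoc 1 l<m
        last : wordSum (m ∸ m) (suc m) ≈ x * W m
        last = begin
          wordSum (m ∸ m) (suc m) ≡⟨ ≡.cong (λ a → wordSum a (suc m)) (ℕ.n∸n≡0 m) ⟩
          wordSum 0 (suc m)       ≈⟨ wordSum-0-suc m ⟩
          x * wordSum 0 m         ≡⟨ ≡.cong (λ a → x * wordSum a m) (ℕ.n∸n≡0 m) ⟨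
          x * W m                 ∎

    wordSum-normalForm : ∀ a l → wordSum a l ≈ ∑₃ l (λ k t f → ∑ (partsBox a l) (λ ps → normalTerm (board (omega ps)) a k t f))
    wordSum-normalForm a l =
      trans (∑-cong-All (All.map (λ {ps} → normalise {ps}) (omega-shape a l)))
            (∑-∑₃-comm (partsBox a l) l (λ ps → normalTerm (board (omega ps)) a))
      where
      normalise : ∀ {ps} → Shape a l ps → y ^ (a ∸ largestPart ps) * ⟦ omega ps ⟧ ≈ ∑₃ l (normalTerm (board (omega ps)) a)
      normalise {ps} (xs≡l , ys≡h , h≤a) = trans (y^*⟦⟧ (a ∸ largestPart ps) (omega ps))
        (reflexive (≡.cong₂ (λ L n → ∑₃ L (normalTerm (board (omega ps)) n)) xs≡l
                      (≡.trans (≡.cong (a ∸ largestPart ps ℕ.+_) ys≡h) (ℕ.m∸n+n≡m h≤a))))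

    expansion : ∀ m → (x + y) ^ m ≈ oreExpansion R μ ν q x y m
    expansion m = begin
      (x + y) ^ m
        ≈⟨ binomial m ⟩
      ∑< (suc m) (λ l → wordSum (m ∸ l) l)
        ≈⟨ ∑-cong (upTo (suc m)) (λ l → trans (wordSum-normalForm (m ∸ l) l)
                                                (∑-cong (upTo (suc l)) (λ k → ∑-cong (upTo (suc (l ∸ k))) (collect l k)))) ⟩
      ∑< (suc m) (λ l → ∑₃ l (λ k t f → H k l t))
        ≈⟨ ∑<-triangle (suc m) (λ k l → ∑< (suc (l ∸ k)) (H k l)) ⟨
      ∑< (suc m) (λ k → ∑< (suc m ∸ k) (λ i → ∑< (suc (k ℕ.+ i ∸ k)) (H k (k ℕ.+ i))))
        ≈⟨ trans (∑-range 0 m _) (∑-cong (upTo (suc m)) (λ k → trans (∑-range k m _)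
                                   (∑-cong (upTo (suc m ∸ k)) (λ i → ∑-range 0 (k ℕ.+ i ∸ k) (H k (k ℕ.+ i)))))) ⟨
      oreExpansion R μ ν q x y m ∎
      where
      H : ℕ → ℕ → ℕ → Carrier
      H k l t = frakO R μ ν q m k l t * y ^ (m ∸ l ∸ t) * x ^ k
      collect : ∀ l k t → ∑ (partsBox (m ∸ l) l) (λ ps → normalTerm (board (omega ps)) (m ∸ l) k t (l ∸ k ∸ t)) ≈ H k l t
      collect l k t = sym (trans (*-cong (*-distribʳ-∑ (y ^ (m ∸ l ∸ t)) (partsBox (m ∸ l) l) _) refl)
                                 (*-distribʳ-∑ (x ^ k) (partsBox (m ∸ l) l) _))

theorem3p2 : ∀ {c ℓ} (R : Ring c ℓ) → let open Ring R in
    (μ ν q x y : Carrier) →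
    Central R μ → Central R ν → Central R q →
    x * y + - (q * y * x) ≈ μ + ν * y →
    (m : ℕ) → pow R (x + y) m ≈ oreExpansion R μ ν q x y m
theorem3p2 R μ ν q x y μ-central ν-central q-central relation =
  Ore.expansion R μ ν q x y μ-central ν-central q-central relation
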